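{- Let $\mathbb{F}$ be a field, let $G$ be a cyclic subgroup of the additive group of $\mathbb{F}$, let $a_1,\dots,a_k$ be distinct non-zero elements of $G$, and let $n$ be a positive integer. Then there exists a triangular configuration $\mathcal{M}$ such that $\dim\ker\mathcal{M}=1$ and there exists a vector $v\in\ker\mathcal{M}$ having $a_1,\dots,a_k$ among its entries. Moreover, $v$ contains each $a_i$ as an entry at least $n$ times, and all entries of $v$ are non-zero.
   Context: A triangular configuration is a 2-dimensional simplicial complex whose maximal simplices are triangles or edges. Its incidence matrix has rows indexed by edges and columns by triangles, with entry $1$ if the edge belongs to the triangle and $0$ otherwise; $\ker\mathcal{M}$ denotes the kernel of this matrix over $\mathbb{F}$, a subspace of $\mathbb{F}^{T(\mathcal{M})}$ with coordinates indexed by the triangles of $\mathcal{M}$. -}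

module Defs where

open import Level using (_⊔_; suc)
open import Algebra.Bundles using (CommutativeRing)
open import Data.Nat.Base as ℕ using (ℕ)
open import Data.Integer.Base using (ℤ; +_; -[1+_])
open import Data.Fin.Base using (Fin; _<_)
open import Data.Fin.Properties using (_≟_)
open import Data.Bool.Base using (Bool; true; false; _∧_; _∨_; if_then_else_)
open import Data.Product.Base using (Σ; ∃; _×_; _,_; proj₁; proj₂)
open import Data.Sum.Base using (_⊎_)
open import Relation.Nullary using (¬_)
open import Relation.Nullary.Decidable using (⌊_⌋)
open import Relation.Binary.PropositionalEquality using (_≡_)
open import Function.Definitions using (Injective)

record Field (c ℓ : Level.Level) : Set (Level.suc (c ⊔ ℓ)) where
  field
    commutativeRing : CommutativeRing c ℓ
  open CommutativeRing commutativeRing public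
  field
    1≉0     : ¬ (1# ≈ 0#)
    inverse : ∀ x → ¬ (x ≈ 0#) → Σ Carrier λ y → (x * y) ≈ 1#

module FieldOps {c ℓ} (F : Field c ℓ) where
  open Field F
  open import Algebra.Properties.Monoid.Mult +-monoid using () renaming (_×_ to _·ℕ_)

  _·ℤ_ : ℤ → Carrier → Carrier
  (+ n)      ·ℤ x = n ·ℕ x
  (-[1+ n ]) ·ℤ x = - (ℕ.suc n ·ℕ x)

  InCyclic : Carrier → Carrier → Set ℓ
  InCyclic g x = ∃ λ (z : ℤ) → x ≈ (z ·ℤ g)

-- Triangular configurations: finite 2-dimensional simplicial complexes
-- whose maximal simplices are triangles or edges.
-- Vertices are Fin nV; a triangle is a strictly increasing triple of
-- vertices; the maximal edges (edges lying in no triangle) are strictly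
-- increasing pairs.

Triple : ℕ → Set
Triple nV = Fin nV × Fin nV × Fin nV

SortedTriple : ∀ {nV} → Triple nV → Set
SortedTriple (a , b , c) = (a < b) × (b < c)

edgeInTri : ∀ {nV} → Fin nV → Fin nV → Triple nV → Bool
edgeInTri u w (a , b , c) =
  (⌊ u ≟ a ⌋ ∧ ⌊ w ≟ b ⌋) ∨ (⌊ u ≟ a ⌋ ∧ ⌊ w ≟ c ⌋) ∨ (⌊ u ≟ b ⌋ ∧ ⌊ w ≟ c ⌋)

vertexInTri : ∀ {nV} → Fin nV → Triple nV → Bool
vertexInTri v (a , b , c) = ⌊ v ≟ a ⌋ ∨ ⌊ v ≟ b ⌋ ∨ ⌊ v ≟ c ⌋

record TriConf : Set where
  field
    nV : ℕ
    nT : ℕ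
    nE : ℕ
    tri        : Fin nT → Triple nV
    tri-sorted : ∀ t → SortedTriple (tri t)
    tri-inj    : Injective _≡_ _≡_ tri
    edge        : Fin nE → Fin nV × Fin nV
    edge-sorted : ∀ e → proj₁ (edge e) < proj₂ (edge e)
    edge-inj    : Injective _≡_ _≡_ edge
    edge-max    : ∀ e t → edgeInTri (proj₁ (edge e)) (proj₂ (edge e)) (tri t) ≡ false
    vertex-cov  : ∀ v → (∃ λ t → vertexInTri v (tri t) ≡ true)
                        ⊎ (∃ λ e → (proj₁ (edge e) ≡ v) ⊎ (proj₂ (edge e) ≡ v))

  IsEdge : Fin nV → Fin nV → Set
  IsEdge u w = (u < w) ×
    ((∃ λ t → edgeInTri u w (tri t) ≡ true) ⊎ (∃ λ e → edge e ≡ (u , w)))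

module Incidence {c ℓ} (F : Field c ℓ) (M : TriConf) where
  open Field F
  open TriConf M
  open import Algebra.Properties.Monoid.Sum +-monoid using (sum)

  incidence : Fin nV → Fin nV → Fin nT → Carrier
  incidence u w t = if edgeInTri u w (tri t) then 1# else 0#

  InKer : (Fin nT → Carrier) → Set ℓ
  InKer x = ∀ u w → IsEdge u w → sum (λ t → incidence u w t * x t) ≈ 0#

  DimKer≡1 : Set (c ⊔ ℓ)
  DimKer≡1 = Σ (Fin nT → Carrier) λ w →
    InKer w × ¬ (∀ t → w t ≈ 0#) ×
    (∀ x → InKer x → Σ Carrier λ λ₀ → ∀ t → x t ≈ (λ₀ * w t))

-- A kernel vector of the cone over a 4-cycle hub – node – hub' – node' (four triangles sharing
-- an apex) alternates in sign around the apex, so it is one value per cone.  On the edges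
-- between hubs and nodes the kernel condition then says: for every node y, the cones through y,
-- read as arcs hub → hub' (y their first node) or hub' → hub (y their second node) weighted by
-- their values, form a circulation on the hubs.  With hubs a, m, p₀, …, p_M the cones are chosen
-- so that the circulations leave one degree of freedom s: at the node T the cycle
-- p₀ → p_M → p_{M-1} → … → p₀ makes all W-cones equal to the Z-cone, at J_u the cycle
-- a → p_u → p_{u+1} → m → a ties U_u, X_u, W_u, Y_u together, and at I_γ the S_γ-cone balances
-- the L_γ cones U_u of block γ, so its value is L_γ s; the node O is balanced automatically.
-- Writing aᵢ = zᵢ g, taking s = g and n blocks of size |zᵢ| for every i, and reading each S-cone
-- at a corner whose sign is that of zᵢ, puts every aᵢ at least n times into a kernel vector whose
-- entries ±s and ±L_γ s are all non-zero.

module Submission where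

open import Defs
import Level
open import Data.Bool.Base using (Bool; true; false; _∧_; _∨_; if_then_else_)
open import Data.Bool.Properties using (∧-zeroʳ; ∧-identityʳ; ∨-identityʳ)
open import Data.Empty using (⊥-elim)
open import Data.Fin.Base as Fin using (Fin; zero; suc; _↑ˡ_; _↑ʳ_; splitAt; toℕ; inject₁; fromℕ; combine; remQuot)
open import Data.Fin.Properties using (_≟_; toℕ<n; toℕ-↑ˡ; toℕ-↑ʳ; ↑ˡ-injective; ↑ʳ-injective; splitAt-↑ˡ; splitAt-↑ʳ; splitAt⁻¹-↑ˡ; splitAt⁻¹-↑ʳ; suc-injective; toℕ-inject₁; inject₁-injective; fromℕ≢inject₁; remQuot-combine; combine-injectiveʳ)
open import Data.Fin.Induction using (<-weakInduction)
open import Data.Integer.Base using (ℤ; +_; -[1+_]; ∣_∣)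
open import Data.Nat.Base as ℕ using (ℕ; zero; suc; _≥_)
import Data.Nat.Properties as ℕ
open import Algebra.Properties.Monoid.Sum ℕ.+-0-monoid using () renaming (sum to sumℕ)
open import Data.Product.Base using (Σ; ∃; _×_; _,_; proj₁; proj₂)
open import Data.Sum.Base using (_⊎_; inj₁; inj₂; [_,_]′)
open import Function.Base using (_∘_)
open import Function.Definitions using (Injective)
open import Relation.Nullary using (¬_; yes; no)
open import Relation.Nullary.Decidable using (⌊_⌋)
open import Relation.Binary.PropositionalEquality as ≡ using (_≡_; _≢_; cong; cong₂; subst)

infix 7 _==_

_==_ : ∀ {n} → Fin n → Fin n → Bool
x == y = ⌊ x ≟ y ⌋

==-refl : ∀ {n} (x : Fin n) → (x == x) ≡ true
==-refl x with x ≟ x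
... | yes _ = ≡.refl
... | no x≢x = ⊥-elim (x≢x ≡.refl)

≢⇒==false : ∀ {n} {x y : Fin n} → x ≢ y → (x == y) ≡ false
≢⇒==false {x = x} {y} x≢y with x ≟ y
... | yes x≡y = ⊥-elim (x≢y x≡y)
... | no _ = ≡.refl

==-injective : ∀ {m n} {f : Fin m → Fin n} → Injective _≡_ _≡_ f →
               ∀ x y → (f x == f y) ≡ (x == y)
==-injective {f = f} f-inj x y with x ≟ y
... | yes ≡.refl = ==-refl (f x)
... | no x≢y = ≢⇒==false (x≢y ∘ f-inj)

suc==suc : ∀ {n} (x y : Fin n) → (suc x == suc y) ≡ (x == y)
suc==suc x y with x ≟ y
... | yes _ = ≡.refl
... | no _ = ≡.refl

↑ˡ≢↑ʳ : ∀ {m n} (x : Fin m) (y : Fin n) → x ↑ˡ n ≢ m ↑ʳ y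
↑ˡ≢↑ʳ {m} {n} x y eq = ℕ.<⇒≢ x<m+y (≡.trans (≡.sym (toℕ-↑ˡ x n)) (≡.trans (cong toℕ eq) (toℕ-↑ʳ m y)))
  where
  x<m+y : toℕ x ℕ.< m ℕ.+ toℕ y
  x<m+y = ℕ.≤-trans (toℕ<n x) (ℕ.m≤m+n m (toℕ y))

↑ˡ==↑ʳ : ∀ {m n} (x : Fin m) (y : Fin n) → ((x ↑ˡ n) == (m ↑ʳ y)) ≡ false
↑ˡ==↑ʳ x y = ≢⇒==false (↑ˡ≢↑ʳ x y)

↑ʳ==↑ˡ : ∀ {m n} (x : Fin m) (y : Fin n) → ((m ↑ʳ y) == (x ↑ˡ n)) ≡ false
↑ʳ==↑ˡ x y = ≢⇒==false (↑ˡ≢↑ʳ x y ∘ ≡.sym)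

data Split (m n : ℕ) : Fin (m ℕ.+ n) → Set where
  left  : (x : Fin m) → Split m n (x ↑ˡ n)
  right : (y : Fin n) → Split m n (m ↑ʳ y)

split : ∀ m {n} (t : Fin (m ℕ.+ n)) → Split m n t
split m {n} t with splitAt m {n} t in eq
... | inj₁ x = subst (Split m n) (splitAt⁻¹-↑ˡ eq) (left x)
... | inj₂ y = subst (Split m n) (splitAt⁻¹-↑ʳ eq) (right y)

module FieldAlgebra {c ℓ} (F : Field c ℓ) where
  open Field F public hiding (zero)
  open import Algebra.Properties.CommutativeMonoid.Sum +-commutativeMonoid public
    using (sum; sum-cong-≋; sum-replicate; sum-replicate-zero; sum-init-last; ∑-distrib-+)
  open import Algebra.Properties.Monoid.Mult +-monoid public using (×-congʳ; ×-homo-+) renaming (_×_ to _·ℕ_)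
  open import Algebra.Properties.CommutativeMonoid.Mult +-commutativeMonoid public using (×-distrib-+)
  open import Algebra.Properties.Semiring.Mult semiring public using (×-comm-*)
  open import Algebra.Properties.AbelianGroup +-abelianGroup public
    using (⁻¹-involutive; ε⁻¹≈ε; ⁻¹-∙-comm; inverseʳ-unique)
    renaming (⁻¹-injective to -‿injective; x∙y⁻¹≈ε⇒x≈y to x-y≈0⇒x≈y)
  open import Algebra.Properties.CommutativeSemigroup +-commutativeSemigroup public using (interchange)
  open import Algebra.Properties.Ring ring public using (-‿distribʳ-*)
  open import Relation.Binary.Reasoning.Setoid setoid public

  ≡⇒≈ : ∀ {x y} → x ≡ y → x ≈ y
  ≡⇒≈ ≡.refl = refl

  -‿+ : ∀ x y → - (x + y) ≈ - x + - y
  -‿+ x y = sym (⁻¹-∙-comm x y)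

  -≉0 : ∀ {x} → ¬ x ≈ 0# → ¬ - x ≈ 0#
  -≉0 x≉0 eq = x≉0 (-‿injective (trans eq (sym ε⁻¹≈ε)))

  +≈0⇒≈- : ∀ x y → x + y ≈ 0# → y ≈ - x
  +≈0⇒≈- = inverseʳ-unique

  -+≈0⇒≈ : ∀ x y → - x + y ≈ 0# → y ≈ x
  -+≈0⇒≈ x y eq = trans (inverseʳ-unique (- x) y eq) (⁻¹-involutive x)

  0+_ : ∀ {x y} → x ≈ 0# → x + y ≈ y
  0+ eq = trans (+-congʳ eq) (+-identityˡ _)

  _+0 : ∀ {x y} → y ≈ 0# → x + y ≈ x
  eq +0 = trans (+-congˡ eq) (+-identityʳ _)

  telescope : ∀ x y z → (x - y) + (y - z) ≈ x - z
  telescope x y z = begin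
    (x - y) + (y - z)     ≈⟨ +-assoc x (- y) (y - z) ⟩
    x + (- y + (y - z))   ≈⟨ +-congˡ (+-assoc (- y) y (- z)) ⟨
    x + ((- y + y) - z)   ≈⟨ +-congˡ (+-congʳ (-‿inverseˡ y)) ⟩
    x + (0# - z)          ≈⟨ +-congˡ (+-identityˡ (- z)) ⟩
    x - z                 ∎

  telescope-cycle : ∀ a b c d → (a - b) + ((b - c) + ((c - d) + (d - a))) ≈ 0#
  telescope-cycle a b c d = begin
    (a - b) + ((b - c) + ((c - d) + (d - a)))  ≈⟨ +-congˡ (+-congˡ (telescope c d a)) ⟩
    (a - b) + ((b - c) + (c - a))              ≈⟨ +-congˡ (telescope b c a) ⟩
    (a - b) + (b - a)                          ≈⟨ telescope a b a ⟩
    a - a                                      ≈⟨ -‿inverseʳ a ⟩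
    0#                                         ∎

  cross-cancel : ∀ a b c d → a + c ≈ d + b → (a - b) + (c - d) ≈ 0#
  cross-cancel a b c d a+c≈d+b = begin
    (a - b) + (c - d)        ≈⟨ interchange a (- b) c (- d) ⟩
    (a + c) + (- b - d)      ≈⟨ +-congʳ a+c≈d+b ⟩
    (d + b) + (- b - d)      ≈⟨ +-assoc d b _ ⟩
    d + (b + (- b - d))      ≈⟨ +-congˡ (+-assoc b (- b) (- d)) ⟨
    d + ((b - b) - d)        ≈⟨ +-congˡ (0+ (-‿inverseʳ b)) ⟩
    d - d                    ≈⟨ -‿inverseʳ d ⟩
    0#                       ∎

  sum-zero : ∀ {n} {f : Fin n → Carrier} → (∀ t → f t ≈ 0#) → sum f ≈ 0#
  sum-zero {n} f≈0 = trans (sum-cong-≋ f≈0) (sum-replicate-zero n)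

  sum-neg : ∀ {n} (f : Fin n → Carrier) → sum (λ t → - f t) ≈ - sum f
  sum-neg {zero} f = sym ε⁻¹≈ε
  sum-neg {suc n} f = trans (+-congˡ (sum-neg (f ∘ suc))) (sym (-‿+ _ _))

  sum-sub : ∀ {n} (f g : Fin n → Carrier) → sum (λ t → f t - g t) ≈ sum f - sum g
  sum-sub f g = trans (∑-distrib-+ f (λ t → - g t)) (+-congˡ (sum-neg g))

  sum-↑ : ∀ m {n} (f : Fin (m ℕ.+ n) → Carrier) →
          sum f ≈ sum (λ t → f (t ↑ˡ n)) + sum (λ t → f (m ↑ʳ t))
  sum-↑ zero f = sym (+-identityˡ _)
  sum-↑ (suc m) f = trans (+-congˡ (sum-↑ m (f ∘ suc))) (sym (+-assoc _ _ _))

  sum-delta : ∀ {n} (f : Fin n → Carrier) (t₀ : Fin n) → (∀ t → t ≢ t₀ → f t ≈ 0#) → sum f ≈ f t₀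
  sum-delta f zero f≈0 = sum-zero (λ t → f≈0 (suc t) λ ()) +0
  sum-delta f (suc t₀) f≈0 =
    trans (0+ (f≈0 zero λ ())) (sum-delta (f ∘ suc) t₀ (λ t t≢t₀ → f≈0 (suc t) (t≢t₀ ∘ suc-injective)))

  ·ℕ-0# : ∀ n → n ·ℕ 0# ≈ 0#
  ·ℕ-0# n = trans (sym (sum-replicate n)) (sum-replicate-zero n)

  ·ℕ-neg : ∀ n x → n ·ℕ (- x) ≈ - (n ·ℕ x)
  ·ℕ-neg zero x = sym ε⁻¹≈ε
  ·ℕ-neg (suc n) x = trans (+-congˡ (·ℕ-neg n x)) (sym (-‿+ _ _))

  when : Bool → Carrier → Carrier
  when true x = x
  when false x = 0#

  when-cong : ∀ b {x y} → x ≈ y → when b x ≈ when b y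
  when-cong true eq = eq
  when-cong false eq = refl

  when-+ : ∀ b x y → when b (x + y) ≈ when b x + when b y
  when-+ true x y = refl
  when-+ false x y = sym (+-identityˡ 0#)

  when-neg : ∀ b x → when b (- x) ≈ - when b x
  when-neg true x = refl
  when-neg false x = sym ε⁻¹≈ε

  when-∧ : ∀ b₁ b₂ x → when (b₁ ∧ b₂) x ≡ when b₂ (when b₁ x)
  when-∧ true b₂ x = ≡.refl
  when-∧ false true x = ≡.refl
  when-∧ false false x = ≡.refl

  when-x-x : ∀ b x → when b x + when b (- x) ≈ 0#
  when-x-x true x = -‿inverseʳ x
  when-x-x false x = +-identityˡ 0#

  sum-when : ∀ b {n} (f : Fin n → Carrier) → sum (λ t → when b (f t)) ≈ when b (sum f)
  sum-when true f = refl
  sum-when false {n} f = sum-zero {n} (λ _ → refl)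

  ·ℕ-when : ∀ n b x → n ·ℕ when b x ≈ when b (n ·ℕ x)
  ·ℕ-when n true x = refl
  ·ℕ-when n false x = ·ℕ-0# n

  sum-when-== : ∀ {n} (t₀ : Fin n) (f : Fin n → Carrier) → sum (λ t → when (t₀ == t) (f t)) ≈ f t₀
  sum-when-== t₀ f =
    trans (sum-delta _ t₀ (λ t t≢t₀ → ≡⇒≈ (cong (λ b → when b (f t)) (≢⇒==false (t≢t₀ ∘ ≡.sym)))))
          (≡⇒≈ (cong (λ b → when b (f t₀)) (==-refl t₀)))

  incidence-when : ∀ b x → (if b then 1# else 0#) * x ≈ when b x
  incidence-when true x = *-identityˡ x
  incidence-when false x = zeroˡ x

-- The triangles of a cone, named by their hub and node: (hub, node), (hub', node),
-- (hub', node'), (hub, node').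
data Corner : Set where
  hi h'i h'j hj : Corner

module CornerSign {c ℓ} (F : Field c ℓ) where
  open FieldAlgebra F

  sign : Corner → Carrier → Carrier
  sign hi  x = x
  sign h'i x = - x
  sign h'j x = x
  sign hj  x = - x

  sign-cong : ∀ b {x y} → x ≈ y → sign b x ≈ sign b y
  sign-cong hi  eq = eq
  sign-cong h'i eq = -‿cong eq
  sign-cong h'j eq = eq
  sign-cong hj  eq = -‿cong eq

  sign-* : ∀ b x y → sign b (x * y) ≈ x * sign b y
  sign-* hi  x y = refl
  sign-* h'i x y = -‿distribʳ-* x y
  sign-* h'j x y = refl
  sign-* hj  x y = -‿distribʳ-* x y

  sign-≉0 : ∀ b {x} → ¬ x ≈ 0# → ¬ sign b x ≈ 0#
  sign-≉0 hi  = λ x≉0 → x≉0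
  sign-≉0 h'i = -≉0
  sign-≉0 h'j = λ x≉0 → x≉0
  sign-≉0 hj  = -≉0

  sign-0# : ∀ b → sign b 0# ≈ 0#
  sign-0# hi  = refl
  sign-0# h'i = ε⁻¹≈ε
  sign-0# h'j = refl
  sign-0# hj  = ε⁻¹≈ε

record QuadSystem : Set where
  field
    nH nN nQ    : ℕ
    hub hub'    : Fin nQ → Fin nH
    node node'  : Fin nQ → Fin nN
    hub≢hub'    : ∀ q → hub q ≢ hub' q
    node≢node'  : ∀ q → node q ≢ node' q
    hub-covered  : ∀ x → Σ (Fin nQ) λ q → (hub q ≡ x) ⊎ (hub' q ≡ x)
    node-covered : ∀ y → Σ (Fin nQ) λ q → (node q ≡ y) ⊎ (node' q ≡ y)

  cornerHub : Fin nQ → Corner → Fin nH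
  cornerHub q hi  = hub q
  cornerHub q h'i = hub' q
  cornerHub q h'j = hub' q
  cornerHub q hj  = hub q

  cornerNode : Fin nQ → Corner → Fin nN
  cornerNode q hi  = node q
  cornerNode q h'i = node q
  cornerNode q h'j = node' q
  cornerNode q hj  = node' q

  corner-injective : ∀ q b b' → cornerHub q b ≡ cornerHub q b' → cornerNode q b ≡ cornerNode q b' → b ≡ b'
  corner-injective q hi  hi  _ _ = ≡.refl
  corner-injective q hi  h'i h _ = ⊥-elim (hub≢hub' q h)
  corner-injective q hi  h'j _ n = ⊥-elim (node≢node' q n)
  corner-injective q hi  hj  _ n = ⊥-elim (node≢node' q n)
  corner-injective q h'i hi  h _ = ⊥-elim (hub≢hub' q (≡.sym h))
  corner-injective q h'i h'i _ _ = ≡.refl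
  corner-injective q h'i h'j _ n = ⊥-elim (node≢node' q n)
  corner-injective q h'i hj  _ n = ⊥-elim (node≢node' q n)
  corner-injective q h'j hi  _ n = ⊥-elim (node≢node' q (≡.sym n))
  corner-injective q h'j h'i _ n = ⊥-elim (node≢node' q (≡.sym n))
  corner-injective q h'j h'j _ _ = ≡.refl
  corner-injective q h'j hj  h _ = ⊥-elim (hub≢hub' q (≡.sym h))
  corner-injective q hj  hi  _ n = ⊥-elim (node≢node' q (≡.sym n))
  corner-injective q hj  h'i _ n = ⊥-elim (node≢node' q (≡.sym n))
  corner-injective q hj  h'j h _ = ⊥-elim (hub≢hub' q h)
  corner-injective q hj  hj  _ _ = ≡.refl

module Cone (Q : QuadSystem) where
  open QuadSystem Q

  nV : ℕ
  nV = nH ℕ.+ (nN ℕ.+ nQ)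

  hubV : Fin nH → Fin nV
  hubV x = x ↑ˡ (nN ℕ.+ nQ)

  nodeV : Fin nN → Fin nV
  nodeV y = nH ↑ʳ (y ↑ˡ nQ)

  apexV : Fin nQ → Fin nV
  apexV q = nH ↑ʳ (nN ↑ʳ q)

  hubV-injective : Injective _≡_ _≡_ hubV
  hubV-injective = ↑ˡ-injective (nN ℕ.+ nQ) _ _

  nodeV-injective : Injective _≡_ _≡_ nodeV
  nodeV-injective = ↑ˡ-injective nQ _ _ ∘ ↑ʳ-injective nH _ _

  apexV-injective : Injective _≡_ _≡_ apexV
  apexV-injective = ↑ʳ-injective nN _ _ ∘ ↑ʳ-injective nH _ _

  data VertexView : Fin nV → Set where
    hubᵛ  : ∀ x → VertexView (hubV x)
    nodeᵛ : ∀ y → VertexView (nodeV y)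
    apexᵛ : ∀ q → VertexView (apexV q)

  vertexView : ∀ v → VertexView v
  vertexView v with split nH v
  ... | left x = hubᵛ x
  ... | right r with split nN r
  ... | left y = nodeᵛ y
  ... | right q = apexᵛ q

  hub<node : ∀ x y → hubV x Fin.< nodeV y
  hub<node x y rewrite toℕ-↑ˡ x (nN ℕ.+ nQ) | toℕ-↑ʳ nH (y ↑ˡ nQ) =
    ℕ.≤-trans (toℕ<n x) (ℕ.m≤m+n nH _)

  node<apex : ∀ y q → nodeV y Fin.< apexV q
  node<apex y q rewrite toℕ-↑ʳ nH (y ↑ˡ nQ) | toℕ-↑ʳ nH (nN ↑ʳ q) | toℕ-↑ˡ y nQ | toℕ-↑ʳ nN q =
    ℕ.+-monoʳ-< nH (ℕ.≤-trans (toℕ<n y) (ℕ.m≤m+n nN _))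

  hub<apex : ∀ x q → hubV x Fin.< apexV q
  hub<apex x q = ℕ.<-trans (hub<node x (node q)) (node<apex (node q) q)

  coneTriple : Fin nQ → Corner → Triple nV
  coneTriple q b = hubV (cornerHub q b) , nodeV (cornerNode q b) , apexV q

  nT : ℕ
  nT = nQ ℕ.+ (nQ ℕ.+ (nQ ℕ.+ nQ))

  triangleAt : Fin nQ → Corner → Fin nT
  triangleAt q hi  = q ↑ˡ _
  triangleAt q h'i = nQ ↑ʳ (q ↑ˡ _)
  triangleAt q h'j = nQ ↑ʳ (nQ ↑ʳ (q ↑ˡ nQ))
  triangleAt q hj  = nQ ↑ʳ (nQ ↑ʳ (nQ ↑ʳ q))

  cornerOf : Fin nT → Fin nQ × Corner
  cornerOf t = [ (_, hi) , (λ t₁ → [ (_, h'i) , (λ t₂ → [ (_, h'j) , (_, hj) ]′ (splitAt nQ t₂)) ]′ (splitAt nQ t₁)) ]′ (splitAt nQ t)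

  cornerOf-triangleAt : ∀ q b → cornerOf (triangleAt q b) ≡ (q , b)
  cornerOf-triangleAt q hi  rewrite splitAt-↑ˡ nQ q (nQ ℕ.+ (nQ ℕ.+ nQ)) = ≡.refl
  cornerOf-triangleAt q h'i rewrite splitAt-↑ʳ nQ (nQ ℕ.+ (nQ ℕ.+ nQ)) (q ↑ˡ (nQ ℕ.+ nQ))
                                  | splitAt-↑ˡ nQ q (nQ ℕ.+ nQ) = ≡.refl
  cornerOf-triangleAt q h'j rewrite splitAt-↑ʳ nQ (nQ ℕ.+ (nQ ℕ.+ nQ)) (nQ ↑ʳ (q ↑ˡ nQ))
                                  | splitAt-↑ʳ nQ (nQ ℕ.+ nQ) (q ↑ˡ nQ)
                                  | splitAt-↑ˡ nQ q nQ = ≡.refl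
  cornerOf-triangleAt q hj  rewrite splitAt-↑ʳ nQ (nQ ℕ.+ (nQ ℕ.+ nQ)) (nQ ↑ʳ (nQ ↑ʳ q))
                                  | splitAt-↑ʳ nQ (nQ ℕ.+ nQ) (nQ ↑ʳ q)
                                  | splitAt-↑ʳ nQ nQ q = ≡.refl

  triangleAt-cornerOf : ∀ t → triangleAt (proj₁ (cornerOf t)) (proj₂ (cornerOf t)) ≡ t
  triangleAt-cornerOf t with split nQ t
  ... | left q rewrite splitAt-↑ˡ nQ q (nQ ℕ.+ (nQ ℕ.+ nQ)) = ≡.refl
  ... | right t₁ rewrite splitAt-↑ʳ nQ (nQ ℕ.+ (nQ ℕ.+ nQ)) t₁ with split nQ t₁
  ... | left q rewrite splitAt-↑ˡ nQ q (nQ ℕ.+ nQ) = ≡.refl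
  ... | right t₂ rewrite splitAt-↑ʳ nQ (nQ ℕ.+ nQ) t₂ with split nQ t₂
  ... | left q rewrite splitAt-↑ˡ nQ q nQ = ≡.refl
  ... | right q rewrite splitAt-↑ʳ nQ nQ q = ≡.refl

  triangleAt-injective : ∀ {q q' b b'} → triangleAt q b ≡ triangleAt q' b' → (q , b) ≡ (q' , b')
  triangleAt-injective {q} {q'} {b} {b'} eq =
    ≡.trans (≡.sym (cornerOf-triangleAt q b)) (≡.trans (cong cornerOf eq) (cornerOf-triangleAt q' b'))

  triangle : Fin nT → Triple nV
  triangle t = coneTriple (proj₁ (cornerOf t)) (proj₂ (cornerOf t))

  triangle-triangleAt : ∀ q b → triangle (triangleAt q b) ≡ coneTriple q b
  triangle-triangleAt q b rewrite cornerOf-triangleAt q b = ≡.refl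

  coneTriple-injective : ∀ {q b q' b'} → coneTriple q b ≡ coneTriple q' b' → (q , b) ≡ (q' , b')
  coneTriple-injective {q} {b} {q'} {b'} eq with apexV-injective (cong (proj₂ ∘ proj₂) eq)
  ... | ≡.refl with corner-injective q b b' (hubV-injective (cong proj₁ eq)) (nodeV-injective (cong (proj₁ ∘ proj₂) eq))
  ... | ≡.refl = ≡.refl

  triangle-injective : Injective _≡_ _≡_ triangle
  triangle-injective {t} {t'} eq = begin
    t                          ≡⟨ triangleAt-cornerOf t ⟨
    triangleAt′ (cornerOf t)   ≡⟨ cong triangleAt′ (coneTriple-injective {q} {b} {q'} {b'} eq) ⟩
    triangleAt′ (cornerOf t')  ≡⟨ triangleAt-cornerOf t' ⟩
    t'                         ∎
    where
    open ≡.≡-Reasoning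
    q q' : Fin nQ
    q = proj₁ (cornerOf t)
    q' = proj₁ (cornerOf t')
    b b' : Corner
    b = proj₂ (cornerOf t)
    b' = proj₂ (cornerOf t')
    triangleAt′ : Fin nQ × Corner → Fin nT
    triangleAt′ (q , b) = triangleAt q b

  hubV==hubV : ∀ x x' → (hubV x == hubV x') ≡ (x == x')
  hubV==hubV = ==-injective hubV-injective
  nodeV==nodeV : ∀ y y' → (nodeV y == nodeV y') ≡ (y == y')
  nodeV==nodeV = ==-injective nodeV-injective
  apexV==apexV : ∀ q q' → (apexV q == apexV q') ≡ (q == q')
  apexV==apexV = ==-injective apexV-injective
  hubV==nodeV : ∀ x y → (hubV x == nodeV y) ≡ false
  hubV==nodeV x _ = ↑ˡ==↑ʳ x _
  hubV==apexV : ∀ x q → (hubV x == apexV q) ≡ false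
  hubV==apexV x _ = ↑ˡ==↑ʳ x _
  nodeV==hubV : ∀ y x → (nodeV y == hubV x) ≡ false
  nodeV==hubV _ x = ↑ʳ==↑ˡ x _
  apexV==hubV : ∀ q x → (apexV q == hubV x) ≡ false
  apexV==hubV _ x = ↑ʳ==↑ˡ x _
  nodeV==apexV : ∀ y q → (nodeV y == apexV q) ≡ false
  nodeV==apexV y q = ≡.trans (==-injective (↑ʳ-injective nH _ _) _ _) (↑ˡ==↑ʳ y q)
  apexV==nodeV : ∀ q y → (apexV q == nodeV y) ≡ false
  apexV==nodeV q y = ≡.trans (==-injective (↑ʳ-injective nH _ _) _ _) (↑ʳ==↑ˡ y q)

  inCone : Fin nV → Fin nV → Fin nQ → Corner → Bool
  inCone u w q b = edgeInTri u w (coneTriple q b)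

  hub-node-inCone : ∀ x y q b → inCone (hubV x) (nodeV y) q b ≡ (x == cornerHub q b ∧ y == cornerNode q b)
  hub-node-inCone x y q b
    rewrite hubV==hubV x (cornerHub q b) | nodeV==nodeV y (cornerNode q b) | nodeV==apexV y q
          | hubV==nodeV x (cornerNode q b) | ∧-zeroʳ (x == cornerHub q b)
          | ∨-identityʳ (x == cornerHub q b ∧ y == cornerNode q b) = ≡.refl

  hub-apex-inCone : ∀ x r q b → inCone (hubV x) (apexV r) q b ≡ (x == cornerHub q b ∧ r == q)
  hub-apex-inCone x r q b
    rewrite hubV==hubV x (cornerHub q b) | apexV==nodeV r (cornerNode q b) | apexV==apexV r q
          | hubV==nodeV x (cornerNode q b) | ∧-zeroʳ (x == cornerHub q b)
          | ∨-identityʳ (x == cornerHub q b ∧ r == q) = ≡.refl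

  node-apex-inCone : ∀ y r q b → inCone (nodeV y) (apexV r) q b ≡ (y == cornerNode q b ∧ r == q)
  node-apex-inCone y r q b
    rewrite nodeV==hubV y (cornerHub q b) | nodeV==nodeV y (cornerNode q b) | apexV==apexV r q = ≡.refl

  hub-hub-inCone : ∀ x x' q b → inCone (hubV x) (hubV x') q b ≡ false
  hub-hub-inCone x x' q b
    rewrite hubV==hubV x (cornerHub q b) | hubV==nodeV x (cornerNode q b) | hubV==nodeV x' (cornerNode q b)
          | hubV==apexV x' q | ∧-zeroʳ (x == cornerHub q b) = ≡.refl

  node-hub-inCone : ∀ y x q b → inCone (nodeV y) (hubV x) q b ≡ false
  node-hub-inCone y x q b
    rewrite nodeV==hubV y (cornerHub q b) | nodeV==nodeV y (cornerNode q b) | hubV==apexV x q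
          | ∧-zeroʳ (y == cornerNode q b) = ≡.refl

  node-node-inCone : ∀ y y' q b → inCone (nodeV y) (nodeV y') q b ≡ false
  node-node-inCone y y' q b
    rewrite nodeV==hubV y (cornerHub q b) | nodeV==nodeV y (cornerNode q b) | nodeV==apexV y' q
          | ∧-zeroʳ (y == cornerNode q b) = ≡.refl

  apex-inCone : ∀ r w q b → inCone (apexV r) w q b ≡ false
  apex-inCone r w q b rewrite apexV==hubV r (cornerHub q b) | apexV==nodeV r (cornerNode q b) = ≡.refl

  inCone-corner : ∀ {u w q b} → edgeInTri u w (coneTriple q b) ≡ true → ∃ λ t → edgeInTri u w (triangle t) ≡ true
  inCone-corner {u} {w} {q} {b} e = triangleAt q b , ≡.trans (cong (edgeInTri u w) (triangle-triangleAt q b)) e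

  vertex-covered : ∀ v → ∃ λ t → vertexInTri v (triangle t) ≡ true
  vertex-covered v = cover (vertexView v)
    where
    inCorner : ∀ v q b → (v ≡ hubV (cornerHub q b)) ⊎ (v ≡ nodeV (cornerNode q b)) ⊎ (v ≡ apexV q) →
               ∃ λ t → vertexInTri v (triangle t) ≡ true
    inCorner v q b v∈ = triangleAt q b , ≡.trans (cong (vertexInTri v) (triangle-triangleAt q b)) (at v∈)
      where
      at : (v ≡ hubV (cornerHub q b)) ⊎ (v ≡ nodeV (cornerNode q b)) ⊎ (v ≡ apexV q) → vertexInTri v (coneTriple q b) ≡ true
      at (inj₁ ≡.refl) rewrite ==-refl (hubV (cornerHub q b)) = ≡.refl
      at (inj₂ (inj₁ ≡.refl)) rewrite ==-refl (nodeV (cornerNode q b)) | nodeV==hubV (cornerNode q b) (cornerHub q b) = ≡.refl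
      at (inj₂ (inj₂ ≡.refl)) rewrite ==-refl (apexV q) | apexV==hubV q (cornerHub q b) | apexV==nodeV q (cornerNode q b) = ≡.refl
    cover : ∀ {v} → VertexView v → ∃ λ t → vertexInTri v (triangle t) ≡ true
    cover (hubᵛ x) with hub-covered x
    ... | q , inj₁ e = inCorner _ q hi (inj₁ (cong hubV (≡.sym e)))
    ... | q , inj₂ e = inCorner _ q h'i (inj₁ (cong hubV (≡.sym e)))
    cover (nodeᵛ y) with node-covered y
    ... | q , inj₁ e = inCorner _ q hi (inj₂ (inj₁ (cong nodeV (≡.sym e))))
    ... | q , inj₂ e = inCorner _ q h'j (inj₂ (inj₁ (cong nodeV (≡.sym e))))
    cover (apexᵛ q) = inCorner _ q hi (inj₂ (inj₂ ≡.refl))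

  complex : TriConf
  complex = record
    { nV = nV ; nT = nT ; nE = 0
    ; tri = triangle
    ; tri-sorted = λ t → hub<node _ _ , node<apex _ _
    ; tri-inj = triangle-injective
    ; edge = λ () ; edge-sorted = λ () ; edge-inj = λ {x} → case0 x
    ; edge-max = λ ()
    ; vertex-cov = inj₁ ∘ vertex-covered }
    where
    case0 : ∀ {A : Set} → Fin 0 → A
    case0 ()

  module Kernel {c ℓ} (F : Field c ℓ) where
    open FieldAlgebra F
    open CornerSign F
    open Incidence F complex using (InKer; incidence; DimKer≡1)
    open TriConf complex using (IsEdge)

    ∑corners : (Corner → Carrier) → Carrier
    ∑corners f = f hi + (f h'i + (f h'j + f hj))

    ∑corners-cong : ∀ {f g} → (∀ b → f b ≈ g b) → ∑corners f ≈ ∑corners g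
    ∑corners-cong eq = +-cong (eq hi) (+-cong (eq h'i) (+-cong (eq h'j) (eq hj)))

    ∑corners-zero : ∀ {f} → (∀ b → f b ≈ 0#) → ∑corners f ≈ 0#
    ∑corners-zero f≈0 = trans (0+ (f≈0 hi)) (trans (0+ (f≈0 h'i)) (trans (0+ (f≈0 h'j)) (f≈0 hj)))

    sum-byCorners : (f : Fin nT → Carrier) → sum f ≈ sum (λ q → ∑corners (λ b → f (triangleAt q b)))
    sum-byCorners f = begin
      sum f                                                        ≈⟨ sum-↑ nQ f ⟩
      S hi + sum (λ t → f (nQ ↑ʳ t))                               ≈⟨ +-congˡ (sum-↑ nQ _) ⟩
      S hi + (S h'i + sum (λ t → f (nQ ↑ʳ (nQ ↑ʳ t))))             ≈⟨ +-congˡ (+-congˡ (sum-↑ nQ _)) ⟩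
      S hi + (S h'i + (S h'j + S hj))                              ≈⟨ +-congˡ (+-congˡ (∑-distrib-+ (g h'j) (g hj))) ⟨
      S hi + (S h'i + sum (λ q → g h'j q + g hj q))                ≈⟨ +-congˡ (∑-distrib-+ (g h'i) _) ⟨
      S hi + sum (λ q → g h'i q + (g h'j q + g hj q))              ≈⟨ ∑-distrib-+ (g hi) _ ⟨
      sum (λ q → ∑corners (λ b → g b q))                           ∎
      where
      g : Corner → Fin nQ → Carrier
      g b q = f (triangleAt q b)
      S : Corner → Carrier
      S b = sum (g b)

    quadTerm : Fin nV → Fin nV → (Fin nT → Carrier) → Fin nQ → Carrier
    quadTerm u w X q = ∑corners (λ b → when (inCone u w q b) (X (triangleAt q b)))

    incidence-sum : ∀ u w X → sum (λ t → incidence u w t * X t) ≈ sum (quadTerm u w X)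
    incidence-sum u w X = trans (sum-byCorners _) (sum-cong-≋ λ q → ∑corners-cong λ b →
      trans (*-congʳ (≡⇒≈ (cong (λ T → if edgeInTri u w T then 1# else 0#) (triangle-triangleAt q b))))
            (incidence-when (inCone u w q b) (X (triangleAt q b))))

    sum-apexEdge : ∀ u r X (at : Fin nQ → Corner → Bool) →
                   (∀ q b → inCone u (apexV r) q b ≡ (at q b ∧ r == q)) →
                   sum (quadTerm u (apexV r) X) ≈ ∑corners (λ b → when (at r b) (X (triangleAt r b)))
    sum-apexEdge u r X at inCone≡ = trans (sum-delta _ r off) (∑corners-cong on)
      where
      off : ∀ q → q ≢ r → quadTerm u (apexV r) X q ≈ 0#
      off q q≢r = ∑corners-zero λ b → ≡⇒≈ (cong (λ β → when β (X (triangleAt q b)))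
        (≡.trans (inCone≡ q b) (≡.trans (cong (at q b ∧_) (≢⇒==false (q≢r ∘ ≡.sym))) (∧-zeroʳ (at q b)))))
      on : ∀ b → when (inCone u (apexV r) r b) (X (triangleAt r b)) ≈ when (at r b) (X (triangleAt r b))
      on b = ≡⇒≈ (cong (λ β → when β (X (triangleAt r b)))
        (≡.trans (inCone≡ r b) (≡.trans (cong (at r b ∧_) (==-refl r)) (∧-identityʳ (at r b)))))

    arc : Fin nH → Fin nH → Fin nH → Carrier → Carrier
    arc x A B c = when (x == A) c + when (x == B) (- c)

    arc-cong : ∀ x A B {v w} → v ≈ w → arc x A B v ≈ arc x A B w
    arc-cong x A B eq = +-cong (when-cong (x == A) eq) (when-cong (x == B) (-‿cong eq))

    arc-difference : ∀ x A B v → arc x A B v ≈ when (x == A) v - when (x == B) v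
    arc-difference x A B v = +-congˡ (when-neg (x == B) v)

    arc-reverse : ∀ x A B v → arc x B A v + arc x A B v ≈ 0#
    arc-reverse x A B v = begin
      arc x B A v + arc x A B v                                       ≈⟨ +-cong (arc-difference x B A v) (arc-difference x A B v) ⟩
      (when (x == B) v - when (x == A) v) + (when (x == A) v - when (x == B) v) ≈⟨ telescope _ _ _ ⟩
      when (x == B) v - when (x == B) v                               ≈⟨ -‿inverseʳ _ ⟩
      0#                                                              ∎

    sum-arc : ∀ {n} x A B (f : Fin n → Carrier) → sum (λ t → arc x A B (f t)) ≈ arc x A B (sum f)
    sum-arc x A B f = trans (∑-distrib-+ (λ t → when (x == A) (f t)) (λ t → when (x == B) (- f t)))
      (+-cong (sum-when (x == A) f) (trans (sum-when (x == B) (λ t → - f t)) (when-cong (x == B) (sum-neg f))))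

    ·ℕ-arc : ∀ n x A B v → n ·ℕ arc x A B v ≈ arc x A B (n ·ℕ v)
    ·ℕ-arc n x A B v = trans (×-distrib-+ _ _ n) (+-cong (·ℕ-when n (x == A) v)
      (trans (·ℕ-when n (x == B) (- v)) (when-cong (x == B) (·ℕ-neg n v))))

    port : Fin nH → Fin nN → Fin nQ → Carrier → Carrier
    port x y q c = when (y == node q) (arc x (hub q) (hub' q) c) + when (y == node' q) (arc x (hub' q) (hub q) c)

    Balanced : (Fin nQ → Carrier) → Set ℓ
    Balanced c = ∀ x y → sum (λ q → port x y q (c q)) ≈ 0#

    BalancedOnEdges : (Fin nQ → Carrier) → Set ℓ
    BalancedOnEdges c = ∀ q b → sum (λ q' → port (cornerHub q b) (cornerNode q b) q' (c q')) ≈ 0#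

    quadTerm-hub-node : ∀ x y X q {c} → (∀ b → X (triangleAt q b) ≈ sign b c) →
                        quadTerm (hubV x) (nodeV y) X q ≈ port x y q c
    quadTerm-hub-node x y X q {c} X≈ = begin
      quadTerm (hubV x) (nodeV y) X q
        ≈⟨ ∑corners-cong (λ b → trans (≡⇒≈ (cong (λ β → when β _) (hub-node-inCone x y q b))) (when-cong (x == cornerHub q b ∧ y == cornerNode q b) (X≈ b))) ⟩
      ∑corners (λ b → when (x == cornerHub q b ∧ y == cornerNode q b) (sign b c))
        ≡⟨ cong₂ _+_ (when-∧ H I c) (cong₂ _+_ (when-∧ H' I (- c)) (cong₂ _+_ (when-∧ H' J c) (when-∧ H J (- c)))) ⟩
      when I (when H c) + (when I (when H' (- c)) + (when J (when H' c) + when J (when H (- c))))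
        ≈⟨ +-assoc _ _ _ ⟨
      (when I (when H c) + when I (when H' (- c))) + (when J (when H' c) + when J (when H (- c)))
        ≈⟨ +-cong (when-+ I _ _) (when-+ J _ _) ⟨
      port x y q c ∎
      where
      H H' I J : Bool
      H = x == hub q
      H' = x == hub' q
      I = y == node q
      J = y == node' q

    alternating : (Fin nQ → Carrier) → Fin nT → Carrier
    alternating c t = sign (proj₂ (cornerOf t)) (c (proj₁ (cornerOf t)))

    alternating-triangleAt : ∀ c q b → alternating c (triangleAt q b) ≡ sign b (c q)
    alternating-triangleAt c q b rewrite cornerOf-triangleAt q b = ≡.refl

    alternating-≉0 : ∀ c → (∀ q → ¬ c q ≈ 0#) → ∀ t → ¬ alternating c t ≈ 0#
    alternating-≉0 c c≉0 t = sign-≉0 (proj₂ (cornerOf t)) (c≉0 (proj₁ (cornerOf t)))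

    alternating-inKer : ∀ c → Balanced c → InKer (alternating c)
    alternating-inKer c balanced u w _ = trans (incidence-sum u w X) (vanish (vertexView u) (vertexView w))
      where
      X : Fin nT → Carrier
      X = alternating c
      X≈ : ∀ q b → X (triangleAt q b) ≈ sign b (c q)
      X≈ q b = ≡⇒≈ (alternating-triangleAt c q b)
      nested : ∀ {a b b' a'} → a + a' ≈ 0# → b + b' ≈ 0# → a + (b + (b' + a')) ≈ 0#
      nested {a} {b} {b'} {a'} aa' bb' = begin
        a + (b + (b' + a'))  ≈⟨ +-congˡ (+-assoc b b' a') ⟨
        a + ((b + b') + a')  ≈⟨ +-congˡ (0+ bb') ⟩
        a + a'               ≈⟨ aa' ⟩
        0#                   ∎
      paired : ∀ {a a' b b'} → a + a' ≈ 0# → b + b' ≈ 0# → a + (a' + (b + b')) ≈ 0#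
      paired aa' bb' = trans (sym (+-assoc _ _ _)) (trans (0+ aa') bb')
      none : ∀ u w → (∀ q b → inCone u w q b ≡ false) → sum (quadTerm u w X) ≈ 0#
      none u w out = sum-zero λ q → ∑corners-zero λ b → ≡⇒≈ (cong (λ β → when β (X (triangleAt q b))) (out q b))
      vanish : ∀ {u w} → VertexView u → VertexView w → sum (quadTerm u w X) ≈ 0#
      vanish (hubᵛ x) (nodeᵛ y) = trans (sum-cong-≋ λ q → quadTerm-hub-node x y X q (X≈ q)) (balanced x y)
      vanish (hubᵛ x) (apexᵛ r) =
        trans (sum-apexEdge (hubV x) r X _ (hub-apex-inCone x r))
              (trans (∑corners-cong λ b → when-cong (x == cornerHub r b) (X≈ r b))
                     (nested (when-x-x (x == hub r) (c r)) (trans (+-comm _ _) (when-x-x (x == hub' r) (c r)))))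
      vanish (nodeᵛ y) (apexᵛ r) =
        trans (sum-apexEdge (nodeV y) r X _ (node-apex-inCone y r))
              (trans (∑corners-cong λ b → when-cong (y == cornerNode r b) (X≈ r b))
                     (paired (when-x-x (y == node r) (c r)) (when-x-x (y == node' r) (c r))))
      vanish (hubᵛ x) (hubᵛ x') = none (hubV x) (hubV x') (hub-hub-inCone x x')
      vanish (nodeᵛ y) (hubᵛ x) = none (nodeV y) (hubV x) (node-hub-inCone y x)
      vanish (nodeᵛ y) (nodeᵛ y') = none (nodeV y) (nodeV y') (node-node-inCone y y')
      vanish {w = w} (apexᵛ r) _ = none (apexV r) w (apex-inCone r w)

    cornerEdge : ∀ {u w} q b → u Fin.< w → inCone u w q b ≡ true → IsEdge u w
    cornerEdge {u} {w} q b u<w e = u<w , inj₁ (inCone-corner {u} {w} {q} {b} e)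

    module _ {X : Fin nT → Carrier} (X∈ker : InKer X) where
      private
        Xat : Fin nQ → Corner → Carrier
        Xat q b = X (triangleAt q b)

        vanishesOn : ∀ {u w} → IsEdge u w → sum (quadTerm u w X) ≈ 0#
        vanishesOn {u} {w} e = trans (sym (incidence-sum u w X)) (X∈ker u w e)

        apexRelation : ∀ {u} r (at : Fin nQ → Corner → Bool) →
                       (∀ q b → inCone u (apexV r) q b ≡ (at q b ∧ r == q)) → IsEdge u (apexV r) →
                       ∑corners (λ b → when (at r b) (Xat r b)) ≈ 0#
        apexRelation {u} r at inCone≡ e = trans (sym (sum-apexEdge u r X at inCone≡)) (vanishesOn e)

        at-hub : ∀ r → Xat r hi + Xat r hj ≈ 0#
        at-hub r = shape (apexRelation r _ (hub-apex-inCone (hub r) r) edge)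
          where
          edge : IsEdge (hubV (hub r)) (apexV r)
          edge = cornerEdge r hi (hub<apex (hub r) r)
                   (≡.trans (hub-apex-inCone (hub r) r r hi) (cong₂ _∧_ (==-refl (hub r)) (==-refl r)))
          shape : ∑corners (λ b → when (hub r == cornerHub r b) (Xat r b)) ≈ 0# → Xat r hi + Xat r hj ≈ 0#
          shape rewrite ==-refl (hub r) | ≢⇒==false (hub≢hub' r) = trans (+-congˡ (sym (trans (0+ refl) (0+ refl))))

        at-node : ∀ r → Xat r hi + Xat r h'i ≈ 0#
        at-node r = shape (apexRelation r _ (node-apex-inCone (node r) r) edge)
          where
          edge : IsEdge (nodeV (node r)) (apexV r)
          edge = cornerEdge r hi (node<apex (node r) r)
                   (≡.trans (node-apex-inCone (node r) r r hi) (cong₂ _∧_ (==-refl (node r)) (==-refl r)))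
          shape : ∑corners (λ b → when (node r == cornerNode r b) (Xat r b)) ≈ 0# → Xat r hi + Xat r h'i ≈ 0#
          shape rewrite ==-refl (node r) | ≢⇒==false (node≢node' r) = trans (+-congˡ (sym (+-identityˡ 0# +0)))

        at-node' : ∀ r → Xat r h'j + Xat r hj ≈ 0#
        at-node' r = shape (apexRelation r _ (node-apex-inCone (node' r) r) edge)
          where
          edge : IsEdge (nodeV (node' r)) (apexV r)
          edge = cornerEdge r h'j (node<apex (node' r) r)
                   (≡.trans (node-apex-inCone (node' r) r r h'j) (cong₂ _∧_ (==-refl (node' r)) (==-refl r)))
          shape : ∑corners (λ b → when (node' r == cornerNode r b) (Xat r b)) ≈ 0# → Xat r h'j + Xat r hj ≈ 0#
          shape rewrite ==-refl (node' r) | ≢⇒==false (node≢node' r ∘ ≡.sym) = trans (sym (trans (0+ refl) (0+ refl)))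

      inKer⇒sign : ∀ q b → X (triangleAt q b) ≈ sign b (X (triangleAt q hi))
      inKer⇒sign q hi  = refl
      inKer⇒sign q h'i = +≈0⇒≈- _ _ (at-node q)
      inKer⇒sign q hj  = +≈0⇒≈- _ _ (at-hub q)
      inKer⇒sign q h'j = trans (+≈0⇒≈- _ _ (trans (+-comm _ _) (at-node' q)))
                               (trans (-‿cong (inKer⇒sign q hj)) (⁻¹-involutive _))

      inKer⇒balancedOnEdges : BalancedOnEdges (λ q → X (triangleAt q hi))
      inKer⇒balancedOnEdges q b = begin
        sum (λ q' → port x y q' (Xat q' hi))  ≈⟨ sum-cong-≋ (λ q' → quadTerm-hub-node x y X q' (inKer⇒sign q')) ⟨
        sum (quadTerm (hubV x) (nodeV y) X)   ≈⟨ vanishesOn edge ⟩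
        0#                                    ∎
        where
        x : Fin nH
        x = cornerHub q b
        y : Fin nN
        y = cornerNode q b
        edge : IsEdge (hubV x) (nodeV y)
        edge = cornerEdge q b (hub<node x y) (≡.trans (hub-node-inCone x y q b) (cong₂ _∧_ (==-refl x) (==-refl y)))

    dimKer≡1 : ∀ w → Balanced w → ¬ (∀ q → w q ≈ 0#) →
               (∀ c → BalancedOnEdges c → Σ Carrier λ λ₀ → ∀ q → c q ≈ λ₀ * w q) → DimKer≡1
    dimKer≡1 w balanced w≉0 spans = alternating w , alternating-inKer w balanced , alternating≉0 , multiple
      where
      alternating≉0 : ¬ (∀ t → alternating w t ≈ 0#)
      alternating≉0 all≈0 = w≉0 λ q → trans (≡⇒≈ (≡.sym (alternating-triangleAt w q hi))) (all≈0 (triangleAt q hi))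
      multiple : ∀ X → InKer X → Σ Carrier λ λ₀ → ∀ t → X t ≈ λ₀ * alternating w t
      multiple X X∈ker with spans _ (inKer⇒balancedOnEdges X∈ker)
      ... | λ₀ , c≈ = λ₀ , λ t →
        let q = proj₁ (cornerOf t) ; b = proj₂ (cornerOf t) in begin
          X t                          ≡⟨ cong X (triangleAt-cornerOf t) ⟨
          X (triangleAt q b)           ≈⟨ inKer⇒sign X∈ker q b ⟩
          sign b (X (triangleAt q hi)) ≈⟨ sign-cong b (c≈ q) ⟩
          sign b (λ₀ * w q)            ≈⟨ sign-* b λ₀ (w q) ⟩
          λ₀ * alternating w t             ∎

blockOf : ∀ {n} (L : Fin n → ℕ) → Fin (sumℕ L) → Fin n
blockOf {suc n} L u = [ (λ _ → zero) , (λ u' → suc (blockOf (L ∘ suc) u')) ]′ (splitAt (L zero) u)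

module BlockSums {c ℓ} (F : Field c ℓ) where
  open FieldAlgebra F

  sum-when-blockOf : ∀ {n} (L : Fin n → ℕ) (γ : Fin n) x → sum (λ u → when (γ == blockOf L u) x) ≈ L γ ·ℕ x
  sum-when-blockOf {suc n} L γ x = trans (sum-↑ (L zero) _) (byBlock γ)
    where
    inFirst : ∀ t → blockOf L (t ↑ˡ sumℕ (L ∘ suc)) ≡ zero
    inFirst t rewrite splitAt-↑ˡ (L zero) t (sumℕ (L ∘ suc)) = ≡.refl
    inRest : ∀ t → blockOf L (L zero ↑ʳ t) ≡ suc (blockOf (L ∘ suc) t)
    inRest t rewrite splitAt-↑ʳ (L zero) (sumℕ (L ∘ suc)) t = ≡.refl
    byBlock : ∀ γ → sum (λ t → when (γ == blockOf L (t ↑ˡ sumℕ (L ∘ suc))) x) +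
                    sum (λ t → when (γ == blockOf L (L zero ↑ʳ t)) x) ≈ L γ ·ℕ x
    byBlock zero = begin
      sum (λ t → when (zero == blockOf L (t ↑ˡ sumℕ (L ∘ suc))) x) + sum (λ t → when (zero == blockOf L (L zero ↑ʳ t)) x)
        ≈⟨ +-cong (sum-cong-≋ λ t → ≡⇒≈ (cong (λ γ' → when (zero == γ') x) (inFirst t)))
                  (sum-zero λ t → ≡⇒≈ (cong (λ γ' → when (zero == γ') x) (inRest t))) ⟩
      sum {L zero} (λ _ → x) + 0#
        ≈⟨ trans (+-identityʳ _) (sum-replicate (L zero)) ⟩
      L zero ·ℕ x ∎
    byBlock (suc γ) = begin
      sum (λ t → when (suc γ == blockOf L (t ↑ˡ sumℕ (L ∘ suc))) x) + sum (λ t → when (suc γ == blockOf L (L zero ↑ʳ t)) x)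
        ≈⟨ 0+ (sum-zero λ t → ≡⇒≈ (cong (λ γ' → when (suc γ == γ') x) (inFirst t))) ⟩
      sum (λ t → when (suc γ == blockOf L (L zero ↑ʳ t)) x)
        ≈⟨ sum-cong-≋ (λ t → ≡⇒≈ (cong (λ β → when β x) (≡.trans (cong (suc γ ==_) (inRest t)) (suc==suc γ _)))) ⟩
      sum (λ t → when (γ == blockOf (L ∘ suc) t) x)
        ≈⟨ sum-when-blockOf (L ∘ suc) γ x ⟩
      L (suc γ) ·ℕ x ∎

  sum-·ℕ : ∀ {n} (L : Fin n → ℕ) x → sum (λ γ → L γ ·ℕ x) ≈ sumℕ L ·ℕ x
  sum-·ℕ {zero} L x = refl
  sum-·ℕ {suc n} L x = trans (+-congˡ (sum-·ℕ (L ∘ suc) x)) (sym (×-homo-+ x (L zero) _))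

module Design (G' : ℕ) (L' : Fin G' → ℕ) where

  G : ℕ
  G = suc G'

  -- The extra block of size 1 makes M ≥ 1, so that the Z-cone has distinct hubs p₀ and p_M.
  L : Fin G → ℕ
  L zero = 1
  L (suc γ) = L' γ

  M : ℕ
  M = sumℕ L

  M' : ℕ
  M' = sumℕ L'

  block : Fin M → Fin G
  block = blockOf L

  nH nN nQ : ℕ
  nH = suc (suc (suc M))
  nN = suc (suc (G ℕ.+ M))
  nQ = suc (G ℕ.+ (M ℕ.+ (M ℕ.+ (M ℕ.+ M))))

  hubA hubM : Fin nH
  hubA = zero
  hubM = suc zero

  hubP : Fin (suc M) → Fin nH
  hubP v = suc (suc v)

  nodeT nodeO : Fin nN
  nodeT = zero
  nodeO = suc zero

  nodeI : Fin G → Fin nN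
  nodeI γ = suc (suc (γ ↑ˡ M))

  nodeJ : Fin M → Fin nN
  nodeJ u = suc (suc (G ↑ʳ u))

  data Kind : Set where
    Z : Kind
    S : Fin G → Kind
    U X W Y : Fin M → Kind

  quadOf : Kind → Fin nQ
  quadOf Z     = zero
  quadOf (S γ) = suc (γ ↑ˡ _)
  quadOf (U u) = suc (G ↑ʳ (u ↑ˡ _))
  quadOf (X u) = suc (G ↑ʳ (M ↑ʳ (u ↑ˡ _)))
  quadOf (W u) = suc (G ↑ʳ (M ↑ʳ (M ↑ʳ (u ↑ˡ M))))
  quadOf (Y u) = suc (G ↑ʳ (M ↑ʳ (M ↑ʳ (M ↑ʳ u))))

  kindOf : Fin nQ → Kind
  kindOf zero = Z
  kindOf (suc q) =
    [ S , (λ q₁ → [ U , (λ q₂ → [ X , (λ q₃ → [ W , Y ]′ (splitAt M q₃)) ]′ (splitAt M q₂)) ]′ (splitAt M q₁)) ]′ (splitAt G q)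

  kindOf-quadOf : ∀ k → kindOf (quadOf k) ≡ k
  kindOf-quadOf Z = ≡.refl
  kindOf-quadOf (S γ) rewrite splitAt-↑ˡ G γ (M ℕ.+ (M ℕ.+ (M ℕ.+ M))) = ≡.refl
  kindOf-quadOf (U u) rewrite splitAt-↑ʳ G (M ℕ.+ (M ℕ.+ (M ℕ.+ M))) (u ↑ˡ (M ℕ.+ (M ℕ.+ M)))
                            | splitAt-↑ˡ M u (M ℕ.+ (M ℕ.+ M)) = ≡.refl
  kindOf-quadOf (X u) rewrite splitAt-↑ʳ G (M ℕ.+ (M ℕ.+ (M ℕ.+ M))) (M ↑ʳ (u ↑ˡ (M ℕ.+ M)))
                            | splitAt-↑ʳ M (M ℕ.+ (M ℕ.+ M)) (u ↑ˡ (M ℕ.+ M))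
                            | splitAt-↑ˡ M u (M ℕ.+ M) = ≡.refl
  kindOf-quadOf (W u) rewrite splitAt-↑ʳ G (M ℕ.+ (M ℕ.+ (M ℕ.+ M))) (M ↑ʳ (M ↑ʳ (u ↑ˡ M)))
                            | splitAt-↑ʳ M (M ℕ.+ (M ℕ.+ M)) (M ↑ʳ (u ↑ˡ M))
                            | splitAt-↑ʳ M (M ℕ.+ M) (u ↑ˡ M)
                            | splitAt-↑ˡ M u M = ≡.refl
  kindOf-quadOf (Y u) rewrite splitAt-↑ʳ G (M ℕ.+ (M ℕ.+ (M ℕ.+ M))) (M ↑ʳ (M ↑ʳ (M ↑ʳ u)))
                            | splitAt-↑ʳ M (M ℕ.+ (M ℕ.+ M)) (M ↑ʳ (M ↑ʳ u))
                            | splitAt-↑ʳ M (M ℕ.+ M) (M ↑ʳ u)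
                            | splitAt-↑ʳ M M u = ≡.refl

  quadOf-kindOf : ∀ q → quadOf (kindOf q) ≡ q
  quadOf-kindOf zero = ≡.refl
  quadOf-kindOf (suc q) with split G q
  ... | left γ rewrite splitAt-↑ˡ G γ (M ℕ.+ (M ℕ.+ (M ℕ.+ M))) = ≡.refl
  ... | right q₁ rewrite splitAt-↑ʳ G (M ℕ.+ (M ℕ.+ (M ℕ.+ M))) q₁ with split M q₁
  ... | left u rewrite splitAt-↑ˡ M u (M ℕ.+ (M ℕ.+ M)) = ≡.refl
  ... | right q₂ rewrite splitAt-↑ʳ M (M ℕ.+ (M ℕ.+ M)) q₂ with split M q₂
  ... | left u rewrite splitAt-↑ˡ M u (M ℕ.+ M) = ≡.refl
  ... | right q₃ rewrite splitAt-↑ʳ M (M ℕ.+ M) q₃ with split M q₃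
  ... | left u rewrite splitAt-↑ˡ M u M = ≡.refl
  ... | right u rewrite splitAt-↑ʳ M M u = ≡.refl

  kindHub kindHub' : Kind → Fin nH
  kindHub Z     = hubP zero
  kindHub (S γ) = hubM
  kindHub (U u) = hubA
  kindHub (X u) = hubA
  kindHub (W u) = hubP (inject₁ u)
  kindHub (Y u) = hubP (suc u)
  kindHub' Z     = hubP (fromℕ M)
  kindHub' (S γ) = hubA
  kindHub' (U u) = hubM
  kindHub' (X u) = hubP (inject₁ u)
  kindHub' (W u) = hubP (suc u)
  kindHub' (Y u) = hubM

  kindNode kindNode' : Kind → Fin nN
  kindNode Z     = nodeT
  kindNode (S γ) = nodeI γ
  kindNode (U u) = nodeI (block u)
  kindNode (X u) = nodeJ u
  kindNode (W u) = nodeJ u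
  kindNode (Y u) = nodeJ u
  kindNode' Z     = nodeO
  kindNode' (S γ) = nodeO
  kindNode' (U u) = nodeJ u
  kindNode' (X u) = nodeO
  kindNode' (W u) = nodeT
  kindNode' (Y u) = nodeO

  inject₁≢suc : ∀ {n} (u : Fin n) → inject₁ u ≢ suc u
  inject₁≢suc u eq = ℕ.1+n≢n (≡.sym (≡.trans (≡.sym (toℕ-inject₁ u)) (cong toℕ eq)))

  nodeI≢nodeJ : ∀ γ u → nodeI γ ≢ nodeJ u
  nodeI≢nodeJ γ u = ↑ˡ≢↑ʳ γ u ∘ suc-injective ∘ suc-injective

  kindHub≢kindHub' : ∀ k → kindHub k ≢ kindHub' k
  kindHub≢kindHub' Z ()
  kindHub≢kindHub' (S γ) ()
  kindHub≢kindHub' (U u) ()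
  kindHub≢kindHub' (X u) ()
  kindHub≢kindHub' (W u) = inject₁≢suc u ∘ suc-injective ∘ suc-injective
  kindHub≢kindHub' (Y u) ()

  kindNode≢kindNode' : ∀ k → kindNode k ≢ kindNode' k
  kindNode≢kindNode' Z ()
  kindNode≢kindNode' (S γ) ()
  kindNode≢kindNode' (U u) = nodeI≢nodeJ (block u) u
  kindNode≢kindNode' (X u) ()
  kindNode≢kindNode' (W u) ()
  kindNode≢kindNode' (Y u) ()

  quads : QuadSystem
  quads = record
    { nH = nH ; nN = nN ; nQ = nQ
    ; hub = kindHub ∘ kindOf ; hub' = kindHub' ∘ kindOf
    ; node = kindNode ∘ kindOf ; node' = kindNode' ∘ kindOf
    ; hub≢hub' = kindHub≢kindHub' ∘ kindOf
    ; node≢node' = kindNode≢kindNode' ∘ kindOf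
    ; hub-covered = hub-covered
    ; node-covered = node-covered }
    where
    hub-covered : ∀ x → Σ (Fin nQ) λ q → (kindHub (kindOf q) ≡ x) ⊎ (kindHub' (kindOf q) ≡ x)
    hub-covered zero = quadOf (U zero) , inj₁ (cong kindHub (kindOf-quadOf (U zero)))
    hub-covered (suc zero) = quadOf (S zero) , inj₁ (cong kindHub (kindOf-quadOf (S zero)))
    hub-covered (suc (suc zero)) = quadOf Z , inj₁ ≡.refl
    hub-covered (suc (suc (suc v))) = quadOf (W v) , inj₂ (cong kindHub' (kindOf-quadOf (W v)))
    node-covered : ∀ y → Σ (Fin nQ) λ q → (kindNode (kindOf q) ≡ y) ⊎ (kindNode' (kindOf q) ≡ y)
    node-covered zero = quadOf Z , inj₁ ≡.refl
    node-covered (suc zero) = quadOf Z , inj₂ ≡.refl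
    node-covered (suc (suc r)) with split G r
    ... | left γ = quadOf (S γ) , inj₁ (cong kindNode (kindOf-quadOf (S γ)))
    ... | right u = quadOf (U u) , inj₂ (cong kindNode' (kindOf-quadOf (U u)))

  open Cone quads public

  hubP==hubP : ∀ v v' → (hubP v == hubP v') ≡ (v == v')
  hubP==hubP v v' = ≡.trans (suc==suc _ _) (suc==suc v v')

  nodeI==nodeI : ∀ γ γ' → (nodeI γ == nodeI γ') ≡ (γ == γ')
  nodeI==nodeI γ γ' = ≡.trans (suc==suc _ _) (≡.trans (suc==suc _ _) (==-injective (↑ˡ-injective M _ _) γ γ'))

  nodeJ==nodeJ : ∀ w u → (nodeJ w == nodeJ u) ≡ (w == u)
  nodeJ==nodeJ w u = ≡.trans (suc==suc _ _) (≡.trans (suc==suc _ _) (==-injective (↑ʳ-injective G _ _) w u))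

  nodeI==nodeJ : ∀ γ u → (nodeI γ == nodeJ u) ≡ false
  nodeI==nodeJ γ u = ≢⇒==false (nodeI≢nodeJ γ u)

  nodeJ==nodeI : ∀ u γ → (nodeJ u == nodeI γ) ≡ false
  nodeJ==nodeI u γ = ≢⇒==false (nodeI≢nodeJ γ u ∘ ≡.sym)

  module Balance {c ℓ} (F : Field c ℓ) where
    open FieldAlgebra F
    open BlockSums F
    open Kernel F

    kindPort : Fin nH → Fin nN → Kind → Carrier → Carrier
    kindPort x y k v = when (y == kindNode k) (arc x (kindHub k) (kindHub' k) v)
                  + when (y == kindNode' k) (arc x (kindHub' k) (kindHub k) v)

    byKind : (Kind → Carrier) → Carrier
    byKind f = f Z + (sum (f ∘ S) + (sum (f ∘ U) + (sum (f ∘ X) + (sum (f ∘ W) + sum (f ∘ Y)))))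

    byKind-cong : ∀ {f g} → (∀ k → f k ≈ g k) → byKind f ≈ byKind g
    byKind-cong eq = +-cong (eq Z) (+-cong (sum-cong-≋ (eq ∘ S)) (+-cong (sum-cong-≋ (eq ∘ U))
                       (+-cong (sum-cong-≋ (eq ∘ X)) (+-cong (sum-cong-≋ (eq ∘ W)) (sum-cong-≋ (eq ∘ Y))))))

    sum-byKind : (f : Fin nQ → Carrier) → sum f ≈ byKind (f ∘ quadOf)
    sum-byKind f = +-congˡ (begin
      sum f₁                                     ≈⟨ sum-↑ G f₁ ⟩
      ΣS + sum f₂                                ≈⟨ +-congˡ (sum-↑ M f₂) ⟩
      ΣS + (ΣU + sum f₃)                         ≈⟨ +-congˡ (+-congˡ (sum-↑ M f₃)) ⟩
      ΣS + (ΣU + (ΣX + sum f₄))                  ≈⟨ +-congˡ (+-congˡ (+-congˡ (sum-↑ M f₄))) ⟩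
      ΣS + (ΣU + (ΣX + (sum (g ∘ W) + sum (g ∘ Y)))) ∎)
      where
      g : Kind → Carrier
      g = f ∘ quadOf
      ΣS ΣU ΣX : Carrier
      ΣS = sum (g ∘ S)
      ΣU = sum (g ∘ U)
      ΣX = sum (g ∘ X)
      f₁ : Fin (G ℕ.+ (M ℕ.+ (M ℕ.+ (M ℕ.+ M)))) → Carrier
      f₁ = f ∘ suc
      f₂ : Fin (M ℕ.+ (M ℕ.+ (M ℕ.+ M))) → Carrier
      f₂ = f₁ ∘ (G ↑ʳ_)
      f₃ : Fin (M ℕ.+ (M ℕ.+ M)) → Carrier
      f₃ = f₂ ∘ (M ↑ʳ_)
      f₄ : Fin (M ℕ.+ M) → Carrier
      f₄ = f₃ ∘ (M ↑ʳ_)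

    sum-port : ∀ (v : Kind → Carrier) x y → sum (λ q → port x y q (v (kindOf q))) ≈ byKind (λ k → kindPort x y k (v k))
    sum-port v x y = trans (sum-byKind (λ q → port x y q (v (kindOf q)))) (byKind-cong {g = λ k → kindPort x y k (v k)} λ k →
      ≡⇒≈ (cong (λ k' → kindPort x y k' (v k')) (kindOf-quadOf k)))

    sum-0+ : ∀ {n} (f : Fin n → Carrier) → sum (λ t → 0# + f t) ≈ sum f
    sum-0+ f = sum-cong-≋ λ t → +-identityˡ (f t)

    zeros : ∀ n → sum {n} (λ _ → 0# + 0#) ≈ 0#
    zeros n = sum-zero {n} (λ _ → +-identityˡ 0#)

    byKind-nodeT : ∀ (v : Kind → Carrier) x → byKind (λ k → kindPort x nodeT k (v k)) ≈
              arc x (hubP zero) (hubP (fromℕ M)) (v Z) + sum (λ u → arc x (hubP (suc u)) (hubP (inject₁ u)) (v (W u)))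
    byKind-nodeT v x = +-cong (+-identityʳ _)
      (trans (0+ (zeros G)) (trans (0+ (zeros M)) (trans (0+ (zeros M))
        (trans (zeros M +0) (sum-0+ λ u → arc x (hubP (suc u)) (hubP (inject₁ u)) (v (W u)))))))

    byKind-nodeO : ∀ (v : Kind → Carrier) x → byKind (λ k → kindPort x nodeO k (v k)) ≈
              arc x (hubP (fromℕ M)) (hubP zero) (v Z) + (sum (λ γ → arc x hubA hubM (v (S γ))) +
              (sum (λ u → arc x (hubP (inject₁ u)) hubA (v (X u))) + sum (λ u → arc x hubM (hubP (suc u)) (v (Y u)))))
    byKind-nodeO v x = +-cong (+-identityˡ _) (+-cong (sum-0+ λ γ → arc x hubA hubM (v (S γ)))
      (trans (0+ (zeros M)) (+-cong (sum-0+ λ u → arc x (hubP (inject₁ u)) hubA (v (X u)))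
        (trans (0+ (zeros M)) (sum-0+ λ u → arc x hubM (hubP (suc u)) (v (Y u)))))))

    portAtI : Fin nH → Fin G → Kind → Carrier → Carrier
    portAtI x γ (S γ') v = when (γ == γ') (arc x hubM hubA v)
    portAtI x γ (U u)  v = when (γ == block u) (arc x hubA hubM v)
    portAtI x γ _      v = 0#

    kindPort-nodeI : ∀ x γ k v → kindPort x (nodeI γ) k v ≈ portAtI x γ k v
    kindPort-nodeI x γ Z      v = +-identityˡ 0#
    kindPort-nodeI x γ (S γ') v rewrite nodeI==nodeI γ γ' = +-identityʳ _
    kindPort-nodeI x γ (U u)  v rewrite nodeI==nodeI γ (block u) | nodeI==nodeJ γ u = +-identityʳ _
    kindPort-nodeI x γ (X u)  v rewrite nodeI==nodeJ γ u = +-identityˡ 0#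
    kindPort-nodeI x γ (W u)  v rewrite nodeI==nodeJ γ u = +-identityˡ 0#
    kindPort-nodeI x γ (Y u)  v rewrite nodeI==nodeJ γ u = +-identityˡ 0#

    byKind-nodeI : ∀ (v : Kind → Carrier) x γ → byKind (λ k → kindPort x (nodeI γ) k (v k)) ≈
              arc x hubM hubA (v (S γ)) + sum (λ u → when (γ == block u) (arc x hubA hubM (v (U u))))
    byKind-nodeI v x γ = trans (byKind-cong {g = λ k → portAtI x γ k (v k)} λ k → kindPort-nodeI x γ k (v k))
      (trans (0+ refl) (+-cong (sum-when-== γ λ γ' → arc x hubM hubA (v (S γ'))) (nothingElse +0)))
      where
      nothingElse : sum {M} (λ _ → 0#) + (sum {M} (λ _ → 0#) + sum {M} (λ _ → 0#)) ≈ 0#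
      nothingElse = trans (0+ (sum-zero {M} λ _ → refl)) (trans (0+ (sum-zero {M} λ _ → refl)) (sum-zero {M} λ _ → refl))

    portAtJ : Fin nH → Fin M → Kind → Carrier → Carrier
    portAtJ x w (U u) v = when (w == u) (arc x hubM hubA v)
    portAtJ x w (X u) v = when (w == u) (arc x hubA (hubP (inject₁ u)) v)
    portAtJ x w (W u) v = when (w == u) (arc x (hubP (inject₁ u)) (hubP (suc u)) v)
    portAtJ x w (Y u) v = when (w == u) (arc x (hubP (suc u)) hubM v)
    portAtJ x w _     v = 0#

    kindPort-nodeJ : ∀ x w k v → kindPort x (nodeJ w) k v ≈ portAtJ x w k v
    kindPort-nodeJ x w Z     v = +-identityˡ 0#
    kindPort-nodeJ x w (S γ) v rewrite nodeJ==nodeI w γ = +-identityˡ 0#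
    kindPort-nodeJ x w (U u) v rewrite nodeJ==nodeI w (block u) | nodeJ==nodeJ w u = +-identityˡ _
    kindPort-nodeJ x w (X u) v rewrite nodeJ==nodeJ w u = +-identityʳ _
    kindPort-nodeJ x w (W u) v rewrite nodeJ==nodeJ w u = +-identityʳ _
    kindPort-nodeJ x w (Y u) v rewrite nodeJ==nodeJ w u = +-identityʳ _

    byKind-nodeJ : ∀ (v : Kind → Carrier) x w → byKind (λ k → kindPort x (nodeJ w) k (v k)) ≈
              arc x hubM hubA (v (U w)) + (arc x hubA (hubP (inject₁ w)) (v (X w)) +
              (arc x (hubP (inject₁ w)) (hubP (suc w)) (v (W w)) + arc x (hubP (suc w)) hubM (v (Y w))))
    byKind-nodeJ v x w = trans (byKind-cong {g = λ k → portAtJ x w k (v k)} λ k → kindPort-nodeJ x w k (v k))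
      (trans (0+ refl) (trans (0+ (sum-zero {G} λ _ → refl))
        (+-cong (sum-when-== w λ u → arc x hubM hubA (v (U u)))
        (+-cong (sum-when-== w λ u → arc x hubA (hubP (inject₁ u)) (v (X u)))
        (+-cong (sum-when-== w λ u → arc x (hubP (inject₁ u)) (hubP (suc u)) (v (W u)))
                (sum-when-== w λ u → arc x (hubP (suc u)) hubM (v (Y u))))))))

    quadValue : Carrier → Kind → Carrier
    quadValue s (S γ) = L γ ·ℕ s
    quadValue s _     = s

    module _ (s : Carrier) (x : Fin nH) where
      private
        atP : Fin (suc M) → Carrier
        atP v = when (x == hubP v) s

        path : atP zero + sum (atP ∘ suc) ≈ sum (atP ∘ inject₁) + atP (fromℕ M)
        path = sum-init-last atP

        Ms atA atM : Carrier
        Ms = M ·ℕ s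
        atA = when (x == hubA) Ms
        atM = when (x == hubM) Ms

        sum-when-const : ∀ b → sum {M} (λ _ → when b s) ≈ when b Ms
        sum-when-const b = trans (sum-when b {M} (λ _ → s)) (when-cong b (sum-replicate M))

      balanced-nodeT : byKind (λ k → kindPort x nodeT k (quadValue s k)) ≈ 0#
      balanced-nodeT = begin
        _ ≈⟨ byKind-nodeT (quadValue s) x ⟩
        arc x (hubP zero) (hubP (fromℕ M)) s + sum (λ u → arc x (hubP (suc u)) (hubP (inject₁ u)) s)
          ≈⟨ +-cong (arc-difference x (hubP zero) (hubP (fromℕ M)) s)
                    (trans (sum-cong-≋ λ u → arc-difference x (hubP (suc u)) (hubP (inject₁ u)) s) (sum-sub (atP ∘ suc) (atP ∘ inject₁))) ⟩
        (atP zero - atP (fromℕ M)) + (sum (atP ∘ suc) - sum (atP ∘ inject₁))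
          ≈⟨ cross-cancel _ _ _ _ path ⟩
        0# ∎

      balanced-nodeO : byKind (λ k → kindPort x nodeO k (quadValue s k)) ≈ 0#
      balanced-nodeO = begin
        _ ≈⟨ byKind-nodeO (quadValue s) x ⟩
        arc x (hubP (fromℕ M)) (hubP zero) s + (sum (λ γ → arc x hubA hubM (L γ ·ℕ s)) +
          (sum (λ u → arc x (hubP (inject₁ u)) hubA s) + sum (λ u → arc x hubM (hubP (suc u)) s)))
          ≈⟨ +-cong (arc-difference x (hubP (fromℕ M)) (hubP zero) s) (+-cong viaS (+-cong viaX viaY)) ⟩
        (atP (fromℕ M) - atP zero) + ((atA - atM) + ((sum (atP ∘ inject₁) - atA) + (atM - sum (atP ∘ suc))))
          ≈⟨ +-congˡ loop ⟩
        (atP (fromℕ M) - atP zero) + (sum (atP ∘ inject₁) - sum (atP ∘ suc))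
          ≈⟨ cross-cancel _ _ _ _ (trans (+-comm _ _) (trans (sym path) (+-comm _ _))) ⟩
        0# ∎
        where
        viaS : sum (λ γ → arc x hubA hubM (L γ ·ℕ s)) ≈ atA - atM
        viaS = trans (sum-arc x hubA hubM (λ γ → L γ ·ℕ s)) (trans (arc-cong x hubA hubM (sum-·ℕ L s)) (arc-difference x hubA hubM Ms))
        viaX : sum (λ u → arc x (hubP (inject₁ u)) hubA s) ≈ sum (atP ∘ inject₁) - atA
        viaX = trans (sum-cong-≋ λ u → arc-difference x (hubP (inject₁ u)) hubA s)
                     (trans (sum-sub (atP ∘ inject₁) (λ _ → when (x == hubA) s)) (+-congˡ (-‿cong (sum-when-const (x == hubA)))))
        viaY : sum (λ u → arc x hubM (hubP (suc u)) s) ≈ atM - sum (atP ∘ suc)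
        viaY = trans (sum-cong-≋ λ u → arc-difference x hubM (hubP (suc u)) s)
                     (trans (sum-sub (λ _ → when (x == hubM) s) (atP ∘ suc)) (+-congʳ (sum-when-const (x == hubM))))
        loop : (atA - atM) + ((sum (atP ∘ inject₁) - atA) + (atM - sum (atP ∘ suc))) ≈ sum (atP ∘ inject₁) - sum (atP ∘ suc)
        loop = trans (sym (+-assoc _ _ _)) (trans (+-congʳ (trans (+-comm _ _) (telescope _ _ _))) (telescope _ _ _))

      balanced-nodeI : ∀ γ → byKind (λ k → kindPort x (nodeI γ) k (quadValue s k)) ≈ 0#
      balanced-nodeI γ = begin
        _ ≈⟨ byKind-nodeI (quadValue s) x γ ⟩
        arc x hubM hubA (L γ ·ℕ s) + sum (λ u → when (γ == block u) (arc x hubA hubM s))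
          ≈⟨ +-congˡ (trans (sum-when-blockOf L γ (arc x hubA hubM s)) (·ℕ-arc (L γ) x hubA hubM s)) ⟩
        arc x hubM hubA (L γ ·ℕ s) + arc x hubA hubM (L γ ·ℕ s)
          ≈⟨ arc-reverse x hubA hubM (L γ ·ℕ s) ⟩
        0# ∎

      balanced-nodeJ : ∀ w → byKind (λ k → kindPort x (nodeJ w) k (quadValue s k)) ≈ 0#
      balanced-nodeJ w = begin
        _ ≈⟨ byKind-nodeJ (quadValue s) x w ⟩
        arc x hubM hubA s + (arc x hubA (hubP (inject₁ w)) s + (arc x (hubP (inject₁ w)) (hubP (suc w)) s + arc x (hubP (suc w)) hubM s))
          ≈⟨ +-cong (arc-difference x hubM hubA s) (+-cong (arc-difference x hubA (hubP (inject₁ w)) s)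
               (+-cong (arc-difference x (hubP (inject₁ w)) (hubP (suc w)) s) (arc-difference x (hubP (suc w)) hubM s))) ⟩
        _ ≈⟨ telescope-cycle _ _ _ _ ⟩
        0# ∎

    quadValue-balanced : ∀ s → Balanced (quadValue s ∘ kindOf)
    quadValue-balanced s x y = trans (sum-port (quadValue s) x y) (balancedAt y)
      where
      balancedAt : ∀ y → byKind (λ k → kindPort x y k (quadValue s k)) ≈ 0#
      balancedAt zero = balanced-nodeT s x
      balancedAt (suc zero) = balanced-nodeO s x
      balancedAt (suc (suc r)) with split G r
      ... | left γ = balanced-nodeI s x γ
      ... | right w = balanced-nodeJ s x w

    module _ {c : Fin nQ → Carrier} (balanced : BalancedOnEdges c) where
      private
        v : Kind → Carrier
        v = c ∘ quadOf

        balanced⇒byKind : ∀ x y → sum (λ q → port x y q (c q)) ≈ 0# → byKind (λ k → kindPort x y k (v k)) ≈ 0#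
        balanced⇒byKind x y eq = trans (sym (sum-port v x y))
          (trans (sum-cong-≋ λ q → ≡⇒≈ (cong (λ q' → port x y q (c q')) (quadOf-kindOf q))) eq)

        balanced-hub-node : ∀ k → byKind (λ k' → kindPort (kindHub k) (kindNode k) k' (v k')) ≈ 0#
        balanced-hub-node k = balanced⇒byKind (kindHub k) (kindNode k)
          (subst (λ k' → sum (λ q → port (kindHub k') (kindNode k') q (c q)) ≈ 0#) (kindOf-quadOf k) (balanced (quadOf k) hi))

        balanced-hub'-node' : ∀ k → byKind (λ k' → kindPort (kindHub' k) (kindNode' k) k' (v k')) ≈ 0#
        balanced-hub'-node' k = balanced⇒byKind (kindHub' k) (kindNode' k)
          (subst (λ k' → sum (λ q → port (kindHub' k') (kindNode' k') q (c q)) ≈ 0#) (kindOf-quadOf k) (balanced (quadOf k) h'j))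

        z₀ : 0# + 0# ≈ 0#
        z₀ = +-identityˡ 0#

        -- Each relation is the balance at one hub–node edge of the complex: at that concrete hub
        -- the arcs reduce to ±(the values of the two cones involved) and 0# elsewhere.
        X≈U : ∀ w → v (X w) ≈ v (U w)
        X≈U w = -+≈0⇒≈ (v (U w)) (v (X w)) (begin
          - v (U w) + v (X w)
            ≈⟨ +-cong (+-identityˡ _) (trans (trans (0+ z₀) z₀ +0) (+-identityʳ _)) ⟨
          _ ≈⟨ byKind-nodeJ v hubA w ⟨
          _ ≈⟨ balanced-hub-node (X w) ⟩
          0# ∎)

        W≈X : ∀ w → v (W w) ≈ v (X w)
        W≈X w = -+≈0⇒≈ (v (X w)) (v (W w)) (trans (sym evaluate) (trans (sym (byKind-nodeJ v p w)) (balanced-hub-node (W w))))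
          where
          p : Fin nH
          p = hubP (inject₁ w)
          evaluate : arc p hubM hubA (v (U w)) + (arc p hubA p (v (X w)) +
                     (arc p p (hubP (suc w)) (v (W w)) + arc p (hubP (suc w)) hubM (v (Y w)))) ≈ - v (X w) + v (W w)
          evaluate rewrite ==-refl p | ≢⇒==false (inject₁≢suc w ∘ suc-injective ∘ suc-injective {i = suc (inject₁ w)}) =
            trans (0+ z₀) (+-cong (+-identityˡ _) (trans (z₀ +0) (+-identityʳ _)))

        Y≈U : ∀ w → v (Y w) ≈ v (U w)
        Y≈U w = sym (x-y≈0⇒x≈y (v (U w)) (v (Y w)) (begin
          v (U w) - v (Y w)
            ≈⟨ +-cong (+-identityʳ _) (trans (0+ z₀) (trans (0+ z₀) (+-identityˡ _))) ⟨
          _ ≈⟨ byKind-nodeJ v hubM w ⟨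
          _ ≈⟨ balanced-hub'-node' (U w) ⟩
          0# ∎))

        W₀≈Z : v (W zero) ≈ v Z
        W₀≈Z = sym (x-y≈0⇒x≈y (v Z) (v (W zero)) (begin
          v Z - v (W zero)
            ≈⟨ +-cong (+-identityʳ _) (trans (zeros M' +0) (+-identityˡ _)) ⟨
          _ ≈⟨ byKind-nodeT v (hubP zero) ⟨
          _ ≈⟨ balanced-hub-node Z ⟩
          0# ∎))

        Wsuc≈W : ∀ u' → v (W (suc u')) ≈ v (W (inject₁ u'))
        Wsuc≈W u' = sym (x-y≈0⇒x≈y (v (W (inject₁ u'))) (v (W (suc u'))) (begin
          v (W (inject₁ u')) - v (W (suc u'))
            ≈⟨ 0+ (trans (+-congˡ (≡⇒≈ (cong (λ β → when β (- v Z)) x≢pM))) z₀) ⟨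
          arc x (hubP zero) (hubP (fromℕ M)) (v Z) + (v (W (inject₁ u')) - v (W (suc u')))
            ≈⟨ +-congˡ (trans (∑-distrib-+ (λ u → when (x == hubP (suc u)) (v (W u))) (λ u → when (x == hubP (inject₁ u)) (- v (W u))))
                                (+-cong forward backward)) ⟨
          _ ≈⟨ byKind-nodeT v x ⟨
          _ ≈⟨ balanced-hub'-node' (W (inject₁ u')) ⟩
          0# ∎))
          where
          x : Fin nH
          x = hubP (suc (inject₁ u'))
          x≢pM : (x == hubP (fromℕ M)) ≡ false
          x≢pM = ≢⇒==false (fromℕ≢inject₁ ∘ ≡.sym ∘ suc-injective ∘ suc-injective ∘ suc-injective)
          forward : sum (λ u → when (x == hubP (suc u)) (v (W u))) ≈ v (W (inject₁ u'))
          forward = trans (sum-cong-≋ λ u → ≡⇒≈ (cong (λ β → when β (v (W u))) (≡.trans (hubP==hubP (suc (inject₁ u')) (suc u)) (suc==suc (inject₁ u') u))))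
                          (sum-when-== (inject₁ u') (v ∘ W))
          backward : sum (λ u → when (x == hubP (inject₁ u)) (- v (W u))) ≈ - v (W (suc u'))
          backward = trans (sum-cong-≋ λ u → ≡⇒≈ (cong (λ β → when β (- v (W u)))
                             (≡.trans (hubP==hubP (suc (inject₁ u')) (inject₁ u)) (==-injective inject₁-injective (suc u') u))))
                           (sum-when-== (suc u') (λ u → - v (W u)))

        W≈Z : ∀ u → v (W u) ≈ v Z
        W≈Z = <-weakInduction (λ u → v (W u) ≈ v Z) W₀≈Z (λ u' ih → trans (Wsuc≈W u') ih)

        U≈Z : ∀ u → v (U u) ≈ v Z
        U≈Z u = trans (sym (X≈U u)) (trans (sym (W≈X u)) (W≈Z u))

        S≈L·Z : ∀ γ → v (S γ) ≈ L γ ·ℕ v Z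
        S≈L·Z γ = x-y≈0⇒x≈y (v (S γ)) (L γ ·ℕ v Z) (begin
          v (S γ) - L γ ·ℕ v Z
            ≈⟨ +-cong (+-identityʳ _) (trans (sum-cong-≋ λ u → when-cong (γ == block u) (trans (+-identityˡ _) (-‿cong (U≈Z u))))
                                             (trans (sum-when-blockOf L γ (- v Z)) (·ℕ-neg (L γ) (v Z)))) ⟨
          _ ≈⟨ byKind-nodeI v hubM γ ⟨
          _ ≈⟨ balanced-hub-node (S γ) ⟩
          0# ∎)

        v≈Z·quadValue : ∀ k → v k ≈ v Z * quadValue 1# k
        v≈Z·quadValue Z     = sym (*-identityʳ _)
        v≈Z·quadValue (S γ) = trans (S≈L·Z γ) (sym (trans (×-comm-* (L γ) (v Z) 1#) (×-congʳ (L γ) (*-identityʳ _))))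
        v≈Z·quadValue (U u) = trans (U≈Z u) (sym (*-identityʳ _))
        v≈Z·quadValue (X u) = trans (X≈U u) (trans (U≈Z u) (sym (*-identityʳ _)))
        v≈Z·quadValue (W u) = trans (W≈Z u) (sym (*-identityʳ _))
        v≈Z·quadValue (Y u) = trans (Y≈U u) (trans (U≈Z u) (sym (*-identityʳ _)))

      balancedOnEdges⇒multiple : Σ Carrier λ λ₀ → ∀ q → c q ≈ λ₀ * quadValue 1# (kindOf q)
      balancedOnEdges⇒multiple = v Z , λ q → trans (≡⇒≈ (cong c (≡.sym (quadOf-kindOf q)))) (v≈Z·quadValue (kindOf q))

    dimension-one : Incidence.DimKer≡1 F complex
    dimension-one = dimKer≡1 (quadValue 1# ∘ kindOf) (quadValue-balanced 1#) (λ all≈0 → 1≉0 (all≈0 zero))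
                      (λ c balanced → balancedOnEdges⇒multiple balanced)

Realizes : ∀ {c ℓ} (F : Field c ℓ) (k : ℕ) → (Fin k → Field.Carrier F) → ℕ → Set (c Level.⊔ ℓ)
Realizes F k a n =
  Σ TriConf λ M →
    Incidence.DimKer≡1 F M ×
    Σ (Fin (TriConf.nT M) → Field.Carrier F) λ v →
      Incidence.InKer F M v ×
      (∀ i → Σ (Fin n → Fin (TriConf.nT M)) λ f →
        Injective _≡_ _≡_ f × (∀ j → Field._≈_ F (v (f j)) (a i))) ×
      (∀ t → ¬ Field._≈_ F (v t) (Field.0# F))

module Realization {c ℓ} (F : Field c ℓ) {k : ℕ} (n : ℕ) (s : Field.Carrier F) (m : Fin k → ℕ) where
  open FieldAlgebra F
  open CornerSign F
  open Design (k ℕ.* n) (m ∘ proj₁ ∘ remQuot n)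
  open Kernel F
  open Balance F

  entry : Fin k → Fin n → Fin G
  entry i j = suc (combine i j)

  L-entry : ∀ i j → L (entry i j) ≡ m i
  L-entry i j = cong (m ∘ proj₁) (remQuot-combine i j)

  realizes : ¬ s ≈ 0# → (a : Fin k → Carrier) (b : Fin k → Corner) →
             (∀ i → ¬ a i ≈ 0#) → (∀ i → sign (b i) (m i ·ℕ s) ≈ a i) → Realizes F k a n
  realizes s≉0 a b a≉0 a≈ = complex , dimension-one , vector , inKer , copies , nonzero
    where
    vector : Fin nT → Carrier
    vector = alternating (quadValue s ∘ kindOf)
    inKer : Incidence.InKer F complex vector
    inKer = alternating-inKer (quadValue s ∘ kindOf) (quadValue-balanced s)
    position : Fin k → Fin n → Fin nT
    position i j = triangleAt (quadOf (S (entry i j))) (b i)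
    position-injective : ∀ i → Injective _≡_ _≡_ (position i)
    position-injective i {j} {j'} eq = combine-injectiveʳ i j i j' (suc-injective (cong unS S≡S))
      where
      quad≡ : quadOf (S (entry i j)) ≡ quadOf (S (entry i j'))
      quad≡ = cong proj₁ (triangleAt-injective {quadOf (S (entry i j))} {quadOf (S (entry i j'))} {b i} {b i} eq)
      S≡S : S (entry i j) ≡ S (entry i j')
      S≡S = ≡.trans (≡.sym (kindOf-quadOf (S (entry i j)))) (≡.trans (cong kindOf quad≡) (kindOf-quadOf (S (entry i j'))))
      unS : Kind → Fin G
      unS (S γ) = γ
      unS _     = zero
    copies : ∀ i → Σ (Fin n → Fin nT) λ f → Injective _≡_ _≡_ f × (∀ j → vector (f j) ≈ a i)
    copies i = position i , position-injective i , λ j → begin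
      vector (position i j)                                ≡⟨ alternating-triangleAt (quadValue s ∘ kindOf) (quadOf (S (entry i j))) (b i) ⟩
      sign (b i) (quadValue s (kindOf (quadOf (S (entry i j))))) ≡⟨ cong (λ k' → sign (b i) (quadValue s k')) (kindOf-quadOf (S (entry i j))) ⟩
      sign (b i) (L (entry i j) ·ℕ s)                      ≡⟨ cong (λ l → sign (b i) (l ·ℕ s)) (L-entry i j) ⟩
      sign (b i) (m i ·ℕ s)                                ≈⟨ a≈ i ⟩
      a i                                                  ∎
    quadValue≉0 : ∀ k' → ¬ quadValue s k' ≈ 0#
    quadValue≉0 Z = s≉0
    quadValue≉0 (S zero) eq = s≉0 (trans (sym (+-identityʳ s)) eq)
    quadValue≉0 (S (suc γ)) eq = a≉0 i (trans (sym (a≈ i)) (trans (sign-cong (b i) eq) (sign-0# (b i))))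
      where
      i : Fin k
      i = proj₁ (remQuot n γ)
    quadValue≉0 (U _) = s≉0
    quadValue≉0 (X _) = s≉0
    quadValue≉0 (W _) = s≉0
    quadValue≉0 (Y _) = s≉0
    nonzero : ∀ t → ¬ vector t ≈ 0#
    nonzero = alternating-≉0 (quadValue s ∘ kindOf) (quadValue≉0 ∘ kindOf)

cornerOfSign : ℤ → Corner
cornerOfSign (+ _)    = hi
cornerOfSign -[1+ _ ] = h'i

module _ {c ℓ} (F : Field c ℓ) where
  open FieldAlgebra F
  open CornerSign F
  open FieldOps F using (_·ℤ_)

  ·ℤ-as-sign : ∀ z g → z ·ℤ g ≈ sign (cornerOfSign z) (∣ z ∣ ·ℕ g)
  ·ℤ-as-sign (+ _)    g = refl
  ·ℤ-as-sign -[1+ _ ] g = refl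

  ·ℤ-0# : ∀ z {g} → g ≈ 0# → z ·ℤ g ≈ 0#
  ·ℤ-0# z {g} g≈0 = trans (·ℤ-as-sign z g)
    (trans (sign-cong (cornerOfSign z) (trans (×-congʳ ∣ z ∣ g≈0) (·ℕ-0# ∣ z ∣))) (sign-0# (cornerOfSign z)))

mainTheorem6 : ∀ {c ℓ} (F : Field c ℓ) (g : Field.Carrier F)
    (k : ℕ) (a : Fin k → Field.Carrier F) (n : ℕ) →
    (∀ i → FieldOps.InCyclic F g (a i)) →
    (∀ i j → Field._≈_ F (a i) (a j) → i ≡ j) →
    (∀ i → ¬ Field._≈_ F (a i) (Field.0# F)) →
    n ≥ 1 →
    Σ TriConf λ M →
      Incidence.DimKer≡1 F M ×
      Σ (Fin (TriConf.nT M) → Field.Carrier F) λ v →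
        Incidence.InKer F M v ×
        (∀ i → Σ (Fin n → Fin (TriConf.nT M)) λ f →
          Injective _≡_ _≡_ f × (∀ j → Field._≈_ F (v (f j)) (a i))) ×
        (∀ t → ¬ Field._≈_ F (v t) (Field.0# F))
mainTheorem6 F g zero a n _ _ _ _ =
  Realization.realizes F n (Field.1# F) (λ ()) (Field.1≉0 F) a (λ ()) (λ ()) (λ ())
mainTheorem6 F g (suc k) a n a∈⟨g⟩ _ a≉0 _ =
  Realization.realizes F n g (∣_∣ ∘ z) g≉0 a (cornerOfSign ∘ z) a≉0 (λ i → sym (trans (proj₂ (a∈⟨g⟩ i)) (·ℤ-as-sign F (z i) g)))
  where
  open Field F using (sym; trans)
  z : Fin (suc k) → ℤ
  z = proj₁ ∘ a∈⟨g⟩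
  g≉0 : ¬ Field._≈_ F g (Field.0# F)
  g≉0 g≈0 = a≉0 zero (trans (proj₂ (a∈⟨g⟩ zero)) (·ℤ-0# F (z zero) g≈0))
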